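{- Let $a,b,c,d$ be positive integers with $ad > bc$ and $\gcd(a,b) = \gcd(c,d) = 1$, and let $x, y \in \mathbb{Z}$ satisfy $ax + by = 1$. Then \begin{align*} &uv(u-1) \left( u^a v^b -1 \right) \mathrm{c}\left( v, u; d, c \right) + uv (v-1) \left( u^c v^d - 1 \right) \mathrm{c}\left( u, v; a, b \right) \\ &\qquad + u^{ a-y } v^{ b+x } \left( u-1 \right) \left( v-1 \right) \mathrm{c}\left( u^a v^b , u^{ -y} v^x ; cx+dy , ad-bc \right) \\ &\qquad = u^{ a+c } v^{ b+d } - u^a v^b (uv-v+1) - u^c v^d (uv-u+1) + uv . \end{align*}
   Context: For positive integers $a,b$ and indeterminates $u,v$, the Dedekind--Carlitz polynomial is $\mathrm{c}(u,v;a,b) := \sum_{k=1}^{b-1} u^{\lfloor ka/b\rfloor} v^{k-1}$; the indeterminates may be replaced by Laurent monomials (as in $\mathrm{c}(u^a v^b, u^{ -y}v^x; \cdot,\cdot)$), and the identity is one of Laurent polynomials in $u,v$. -}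

module Defs where

open import Data.Nat as ℕ using (ℕ; zero; suc)
open import Data.Nat.DivMod as ℕD using ()
open import Data.Integer as ℤ using (ℤ; +_; -[1+_])
open import Data.Integer.Properties using (_≟_)
open import Data.Product using (_×_; _,_)
open import Data.List using (List; []; _∷_; _++_; map; concatMap; foldr)
open import Relation.Nullary.Decidable using (does)
open import Data.Bool using (if_then_else_; _∧_)
open import Relation.Binary.PropositionalEquality using (_≡_)

floorDiv : ℤ → (d : ℕ) → .{{ℕ.NonZero d}} → ℤ
floorDiv (+ n) d = + (n ℕD./ d)
floorDiv -[1+ n ] d = -[1+ (n ℕD./ d) ]

-- Laurent monomials u^i v^j, represented by their exponent pair (i , j).
Mono : Set
Mono = ℤ × ℤ

_·m_ : Mono → Mono → Mono
(i , j) ·m (k , l) = (i ℤ.+ k , j ℤ.+ l)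

_^m_ : Mono → ℤ → Mono
(i , j) ^m n = (n ℤ.* i , n ℤ.* j)

-- Laurent polynomials in u, v with integer coefficients, represented as
-- formal sums of terms  coeff · u^i v^j  (a list of (coeff , (i , j))).
-- Two representations denote the same Laurent polynomial iff they have the
-- same coefficient at every monomial (see _≈L_).
LPoly : Set
LPoly = List (ℤ × Mono)

coeff : LPoly → Mono → ℤ
coeff [] m = + 0
coeff ((c , (i , j)) ∷ p) (k , l) =
  (if does (i ≟ k) ∧ does (j ≟ l) then c else + 0) ℤ.+ coeff p (k , l)

_≈L_ : LPoly → LPoly → Set
p ≈L q = ∀ m → coeff p m ≡ coeff q m

infix 4 _≈L_
infixl 6 _+L_ _-L_
infixl 7 _*L_

mono : Mono → LPoly
mono m = (+ 1 , m) ∷ []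

const : ℤ → LPoly
const c = (c , (+ 0 , + 0)) ∷ []

_+L_ : LPoly → LPoly → LPoly
p +L q = p ++ q

-L_ : LPoly → LPoly
-L p = map (λ { (c , m) → (ℤ.- c , m) }) p

_-L_ : LPoly → LPoly → LPoly
p -L q = p +L (-L q)

_*L_ : LPoly → LPoly → LPoly
p *L q = concatMap (λ { (c , m) → map (λ { (c' , m') → (c ℤ.* c' , m ·m m') }) q }) p

U V : Mono
U = (+ 1 , + 0)
V = (+ 0 , + 1)

-- Dedekind–Carlitz polynomial c(u, v; a, b) = Σ_{k=1}^{b-1} u^{⌊ka/b⌋} v^{k-1},
-- for Laurent monomials u, v, integer a and positive integer b.
dcSum : (u v : Mono) (a : ℤ) (b : ℕ) .{{_ : ℕ.NonZero b}} → ℕ → LPoly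
dcSum u v a b zero = []
dcSum u v a b (suc k) =
  dcSum u v a b k +L
  mono ((u ^m floorDiv (+ (suc k) ℤ.* a) b) ·m (v ^m (+ k)))

DC : (u v : Mono) (a : ℤ) (b : ℕ) .{{_ : ℕ.NonZero b}} → LPoly
DC u v a b = dcSum u v a b (b ℕ.∸ 1)

module Submission where

-- Three-term reciprocity for Dedekind–Carlitz polynomials, proved by comparing
-- the coefficients of both sides at every monomial u^k v^l.

open import Defs

module Proof where
  open import Data.Nat as ℕ using (ℕ; zero; suc)
  open import Data.Nat.GCD using (gcd; gcd-comm)
  open import Data.Integer as ℤ using (ℤ; +_; -[1+_]; _+_; _*_; _-_; -_; _≤_; _<_; +≤+)
  import Data.Integer.Properties as ℤP
  open ℤP using (_≟_; _≤?_; _<?_)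
  open import Data.Integer.Tactic.RingSolver using (solve-∀)
  open import Data.Empty using (⊥; ⊥-elim)
  open import Data.Product using (_×_; _,_; proj₁; proj₂)
  open import Data.Sum using (_⊎_; inj₁; inj₂)
  open import Relation.Nullary using (¬_; Dec; yes; no)
  open import Relation.Nullary.Decidable using (does; _×-dec_)
  open import Relation.Binary.PropositionalEquality

  cong₃ : ∀ (f : ℤ → ℤ → ℤ → ℤ) {x x′ y y′ z z′} → x ≡ x′ → y ≡ y′ → z ≡ z′ → f x y z ≡ f x′ y′ z′
  cong₃ f refl refl refl = refl

  cong₄ : ∀ (f : ℤ → ℤ → ℤ → ℤ → ℤ) {p p′ q q′ r r′ s s′} → p ≡ p′ → q ≡ q′ → r ≡ r′ → s ≡ s′ →
          f p q r s ≡ f p′ q′ r′ s′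
  cong₄ f refl refl refl refl = refl

  module Brackets where
    open import Data.Bool using (Bool; true; false; _∧_)
    open import Relation.Binary.Definitions using (tri<; tri≈; tri>)

    ⌊_⌋ : Bool → ℤ
    ⌊ true ⌋ = + 1
    ⌊ false ⌋ = + 0

    ⟦_<_⟧ ⟦_≤_⟧ ⟦_≡_⟧ : ℤ → ℤ → ℤ
    ⟦ x < y ⟧ = ⌊ does (x <? y) ⌋
    ⟦ x ≤ y ⟧ = ⌊ does (x ≤? y) ⌋
    ⟦ x ≡ y ⟧ = ⌊ does (x ≟ y) ⌋

    ⌊∧⌋ : ∀ s t → ⌊ s ∧ t ⌋ ≡ ⌊ s ⌋ * ⌊ t ⌋
    ⌊∧⌋ true true = refl
    ⌊∧⌋ true false = refl
    ⌊∧⌋ false t = refl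

    does-⇔ : ∀ {P Q : Set} (p : Dec P) (q : Dec Q) → (P → Q) → (Q → P) → does p ≡ does q
    does-⇔ (yes _) (yes _) f g = refl
    does-⇔ (yes p) (no ¬q) f g = ⊥-elim (¬q (f p))
    does-⇔ (no ¬p) (yes q) f g = ⊥-elim (¬p (g q))
    does-⇔ (no _) (no _) f g = refl

    ⌊yes⌋ : ∀ {P : Set} (p : Dec P) → P → ⌊ does p ⌋ ≡ + 1
    ⌊yes⌋ (yes _) _ = refl
    ⌊yes⌋ (no ¬p) p = ⊥-elim (¬p p)

    ⌊no⌋ : ∀ {P : Set} (p : Dec P) → ¬ P → ⌊ does p ⌋ ≡ + 0
    ⌊no⌋ (yes p) ¬p = ⊥-elim (¬p p)
    ⌊no⌋ (no _) _ = refl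

    -- Every inequality is recorded as the
    -- non-negativity of a difference (x < y as  Nonneg (y - x - 1)); new ones are
    -- obtained by adding and multiplying non-negative quantities and recasting
    -- along a ring identity.
    Nonneg : ℤ → Set
    Nonneg x = + 0 ≤ x

    cast : ∀ {x y} → Nonneg x → x ≡ y → Nonneg y
    cast p refl = p

    nonneg-+ : ∀ {x y} → Nonneg x → Nonneg y → Nonneg (x + y)
    nonneg-+ = ℤP.+-mono-≤

    nonneg-* : ∀ {x y} → Nonneg x → Nonneg y → Nonneg (x * y)
    nonneg-* {x} {y} p q =
      subst (_≤ x * y) (ℤP.*-zeroʳ x) (ℤP.*-monoˡ-≤-nonNeg x {{ℤ.nonNegative p}} q)

    nonneg-ℕ : ∀ n → Nonneg (+ n)
    nonneg-ℕ n = +≤+ ℕ.z≤n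

    -1-negative : ¬ Nonneg -[1+ 0 ]
    -1-negative ()

    ≤⇒nonneg : ∀ {x y} → x ≤ y → Nonneg (y - x)
    ≤⇒nonneg = ℤP.i≤j⇒0≤j-i

    nonneg⇒≤ : ∀ {x y} → Nonneg (y - x) → x ≤ y
    nonneg⇒≤ = ℤP.0≤i-j⇒j≤i

    <⇒nonneg : ∀ {x y} → x < y → Nonneg (y - x - + 1)
    <⇒nonneg {x} {y} p = cast (≤⇒nonneg (ℤP.i<j⇒suc[i]≤j p)) (shift x y)
      where shift : ∀ x y → y - (+ 1 + x) ≡ y - x - + 1
            shift = solve-∀

    nonneg⇒< : ∀ {x y} → Nonneg (y - x - + 1) → x < y
    nonneg⇒< {x} {y} p = ℤP.suc[i]≤j⇒i<j (nonneg⇒≤ (cast p (shift x y)))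
      where shift : ∀ x y → y - x - + 1 ≡ y - (+ 1 + x)
            shift = solve-∀

    nonneg-opposite : ∀ {x} → Nonneg x → Nonneg (- x - + 1) → ⊥
    nonneg-opposite {x} p q = -1-negative (cast (nonneg-+ p q) (sum x))
      where sum : ∀ x → x + (- x - + 1) ≡ -[1+ 0 ]
            sum = solve-∀

    ⟦<⟧-one : ∀ {x y} → Nonneg (y - x - + 1) → ⟦ x < y ⟧ ≡ + 1
    ⟦<⟧-one {x} {y} p = ⌊yes⌋ (x <? y) (nonneg⇒< p)

    ⟦<⟧-zero : ∀ {x y} → Nonneg (x - y) → ⟦ x < y ⟧ ≡ + 0
    ⟦<⟧-zero {x} {y} p = ⌊no⌋ (x <? y) (λ x<y → nonneg-opposite p (cast (<⇒nonneg x<y) (flip x y)))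
      where flip : ∀ x y → y - x - + 1 ≡ - (x - y) - + 1
            flip = solve-∀

    ⟦≤⟧-one : ∀ {x y} → Nonneg (y - x) → ⟦ x ≤ y ⟧ ≡ + 1
    ⟦≤⟧-one {x} {y} p = ⌊yes⌋ (x ≤? y) (nonneg⇒≤ p)

    ⟦≤⟧-zero : ∀ {x y} → Nonneg (x - y - + 1) → ⟦ x ≤ y ⟧ ≡ + 0
    ⟦≤⟧-zero {x} {y} p = ⌊no⌋ (x ≤? y) (λ x≤y → nonneg-opposite (≤⇒nonneg x≤y) (cast p (flip x y)))
      where flip : ∀ x y → x - y - + 1 ≡ - (y - x) - + 1
            flip = solve-∀

    ⟦≡⟧-one : ∀ {x y} → x ≡ y → ⟦ x ≡ y ⟧ ≡ + 1
    ⟦≡⟧-one {x} {y} = ⌊yes⌋ (x ≟ y)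

    ⟦≡⟧-zero : ∀ {x y} → ¬ x ≡ y → ⟦ x ≡ y ⟧ ≡ + 0
    ⟦≡⟧-zero {x} {y} = ⌊no⌋ (x ≟ y)

    ⟦≡⟧-zero< : ∀ {x y} → Nonneg (y - x - + 1) → ⟦ x ≡ y ⟧ ≡ + 0
    ⟦≡⟧-zero< {x} {y} p = ⟦≡⟧-zero {x} {y} (λ { refl → -1-negative (cast p (self x)) })
      where self : ∀ x → x - x - + 1 ≡ -[1+ 0 ]
            self = solve-∀

    ⟦≡⟧-zero> : ∀ {x y} → Nonneg (x - y - + 1) → ⟦ x ≡ y ⟧ ≡ + 0
    ⟦≡⟧-zero> {x} {y} p = ⟦≡⟧-zero {x} {y} (λ { refl → -1-negative (cast p (self x)) })
      where self : ∀ x → x - x - + 1 ≡ -[1+ 0 ]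
            self = solve-∀

    ⟦≤⟧-shift : ∀ {x y x' y'} → y - x ≡ y' - x' → ⟦ x ≤ y ⟧ ≡ ⟦ x' ≤ y' ⟧
    ⟦≤⟧-shift {x} {y} {x'} {y'} e = cong ⌊_⌋ (does-⇔ (x ≤? y) (x' ≤? y')
      (λ p → nonneg⇒≤ (cast (≤⇒nonneg p) e)) (λ p → nonneg⇒≤ (cast (≤⇒nonneg p) (sym e))))

    ⟦<⟧-shift : ∀ {x y x' y'} → y - x ≡ y' - x' → ⟦ x < y ⟧ ≡ ⟦ x' < y' ⟧
    ⟦<⟧-shift {x} {y} {x'} {y'} e = cong ⌊_⌋ (does-⇔ (x <? y) (x' <? y')
      (λ p → nonneg⇒< (cast (<⇒nonneg p) (cong (_- + 1) e)))
      (λ p → nonneg⇒< (cast (<⇒nonneg p) (cong (_- + 1) (sym e)))))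

    ⟦≡⟧-shift : ∀ {x y x' y'} → y - x ≡ y' - x' → ⟦ x ≡ y ⟧ ≡ ⟦ x' ≡ y' ⟧
    ⟦≡⟧-shift {x} {y} {x'} {y'} e = cong ⌊_⌋ (does-⇔ (x ≟ y) (x' ≟ y')
      (λ p → diff-zero (trans (sym e) (zero-diff p))) (λ p → diff-zero (trans e (zero-diff p))))
      where
      zero-diff : ∀ {x y} → x ≡ y → y - x ≡ + 0
      zero-diff {x} refl = ℤP.+-inverseʳ x
      diff-zero : ∀ {x y} → y - x ≡ + 0 → x ≡ y
      diff-zero {x} {y} e = trans (sym (ℤP.+-identityʳ x)) (trans (cong (λ w → x + w) (sym e)) (cancel x y))
        where cancel : ∀ x y → x + (y - x) ≡ y
              cancel = solve-∀

    ⟦≡⟧-sym : ∀ x y → ⟦ x ≡ y ⟧ ≡ ⟦ y ≡ x ⟧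
    ⟦≡⟧-sym x y = cong ⌊_⌋ (does-⇔ (x ≟ y) (y ≟ x) sym sym)

    trichotomy : ∀ x y → Nonneg (y - x - + 1) ⊎ x ≡ y ⊎ Nonneg (x - y - + 1)
    trichotomy x y with ℤP.<-cmp x y
    ... | tri< p _ _ = inj₁ (<⇒nonneg p)
    ... | tri≈ _ p _ = inj₂ (inj₁ p)
    ... | tri> _ _ p = inj₂ (inj₂ (<⇒nonneg p))

    ≤-or-> : ∀ x y → Nonneg (y - x) ⊎ Nonneg (x - y - + 1)
    ≤-or-> x y with x ≤? y
    ... | yes p = inj₁ (≤⇒nonneg p)
    ... | no p = inj₂ (<⇒nonneg (ℤP.≰⇒> p))

    positive-factor : ∀ {k x} → Nonneg (k - + 1) → Nonneg (k * x - + 1) → Nonneg (x - + 1)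
    positive-factor {k} {x} pk p with ≤-or-> x (+ 0)
    ... | inj₂ q = cast q (drop-zero x)
      where drop-zero : ∀ x → x - + 0 - + 1 ≡ x - + 1
            drop-zero = solve-∀
    ... | inj₁ q = ⊥-elim (-1-negative (cast (nonneg-+ p (nonneg-* (nonneg-+ pk (nonneg-ℕ 1)) q)) (sum k x)))
      where sum : ∀ k x → k * x - + 1 + (k - + 1 + + 1) * (+ 0 - x) ≡ -[1+ 0 ]
            sum = solve-∀

    nonpositive-factor : ∀ {k x} → Nonneg (k - + 1) → Nonneg (+ 0 - k * x) → Nonneg (+ 0 - x)
    nonpositive-factor {k} {x} pk p with ≤-or-> x (+ 0)
    ... | inj₁ q = q
    ... | inj₂ q = ⊥-elim (-1-negative (cast (nonneg-+ p (nonneg-+ (nonneg-* (nonneg-+ pk (nonneg-ℕ 1)) q) pk)) (sum k x)))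
      where sum : ∀ k x → + 0 - k * x + ((k - + 1 + + 1) * (x - + 0 - + 1) + (k - + 1)) ≡ -[1+ 0 ]
            sum = solve-∀

    positive-sum : ∀ {k l x y} → Nonneg (k - + 1) → Nonneg (l - + 1) → Nonneg (x - + 0 - + 1) → Nonneg (y - + 0 - + 1) →
                   Nonneg (k * x + l * y - + 1)
    positive-sum {k} {l} {x} {y} k≥1 l≥1 x>0 y>0 =
      cast (nonneg-+ (nonneg-+ (nonneg-* (nonneg-+ k≥1 (nonneg-ℕ 1)) x>0) (nonneg-* (nonneg-+ l≥1 (nonneg-ℕ 1)) y>0))
                     (nonneg-+ k≥1 (nonneg-+ l≥1 (nonneg-ℕ 1))))
           (combination k l x y)
      where combination : ∀ k l x y → (k - + 1 + + 1) * (x - + 0 - + 1) + (l - + 1 + + 1) * (y - + 0 - + 1)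
                                        + (k - + 1 + (l - + 1 + + 1)) ≡ k * x + l * y - + 1
            combination = solve-∀

    nonpositive-sum : ∀ {k l x y} → Nonneg (k - + 1) → Nonneg (l - + 1) → Nonneg (+ 0 - x) → Nonneg (+ 0 - y) →
                      Nonneg (+ 0 - (k * x + l * y))
    nonpositive-sum {k} {l} {x} {y} k≥1 l≥1 x≤0 y≤0 =
      cast (nonneg-+ (nonneg-* (nonneg-+ k≥1 (nonneg-ℕ 1)) x≤0) (nonneg-* (nonneg-+ l≥1 (nonneg-ℕ 1)) y≤0))
           (combination k l x y)
      where combination : ∀ k l x y → (k - + 1 + + 1) * (+ 0 - x) + (l - + 1 + + 1) * (+ 0 - y) ≡ + 0 - (k * x + l * y)
            combination = solve-∀

    ⟦<⟧-as-⟦≤⟧ : ∀ x y → ⟦ x < y ⟧ ≡ ⟦ x + + 1 ≤ y ⟧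
    ⟦<⟧-as-⟦≤⟧ x y = cong ⌊_⌋ (does-⇔ (x <? y) ((x + + 1) ≤? y)
      (λ p → nonneg⇒≤ (cast (<⇒nonneg p) (shift x y))) (λ p → nonneg⇒< (cast (≤⇒nonneg p) (sym (shift x y)))))
      where shift : ∀ x y → y - x - + 1 ≡ y - (x + + 1)
            shift = solve-∀

    private
      split-below : ∀ p x → p - x - + 1 + + 1 ≡ p + + 1 - x - + 1
      split-below = solve-∀
      split-at : ∀ x → + 0 ≡ x + + 1 - x - + 1
      split-at = solve-∀
      split-above₁ : ∀ p x → x - p - + 1 + + 1 ≡ x - p
      split-above₁ = solve-∀
      split-above₂ : ∀ p x → x - p - + 1 ≡ x - (p + + 1)
      split-above₂ = solve-∀

    ⟦≤⟧-split : ∀ p x → ⟦ p ≤ x ⟧ ≡ ⟦ p + + 1 ≤ x ⟧ + ⟦ x ≡ p ⟧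
    ⟦≤⟧-split p x with trichotomy x p
    ... | inj₁ q rewrite ⟦≤⟧-zero {p} {x} q | ⟦≤⟧-zero {p + + 1} {x} (cast (nonneg-+ q (nonneg-ℕ 1)) (split-below p x))
                       | ⟦≡⟧-zero< {x} {p} q = refl
    ... | inj₂ (inj₁ refl) rewrite ⟦≤⟧-one {x} {x} (cast (nonneg-ℕ 0) (sym (ℤP.+-inverseʳ x)))
                                 | ⟦≤⟧-zero {x + + 1} {x} (cast (nonneg-ℕ 0) (split-at x)) | ⟦≡⟧-one {x} {x} refl = refl
    ... | inj₂ (inj₂ q) rewrite ⟦≤⟧-one {p} {x} (cast (nonneg-+ q (nonneg-ℕ 1)) (split-above₁ p x))
                              | ⟦≤⟧-one {p + + 1} {x} (cast q (split-above₂ p x)) | ⟦≡⟧-zero> {x} {p} q = refl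

    ⟦≤⟧-as-<+≡ : ∀ x y → ⟦ x ≤ y ⟧ ≡ ⟦ x < y ⟧ + ⟦ x ≡ y ⟧
    ⟦≤⟧-as-<+≡ x y = trans (⟦≤⟧-split x y) (cong₂ _+_ (sym (⟦<⟧-as-⟦≤⟧ x y)) (⟦≡⟧-sym y x))

    private
      window-below₁ : ∀ lo hi x → lo - x - + 1 + (hi - lo) + + 1 ≡ hi + + 1 - x - + 1
      window-below₁ = solve-∀
      window-below₂ : ∀ lo hi x → lo - x - + 1 + (hi - lo) ≡ hi - x - + 1
      window-below₂ = solve-∀
      window-inside₁ : ∀ x hi → hi - x - + 1 ≡ hi - + 1 - x
      window-inside₁ = solve-∀
      window-inside₂ : ∀ x hi → hi - x - + 1 + + 1 ≡ hi + + 1 - x - + 1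
      window-inside₂ = solve-∀
      window-at : ∀ x → + 0 ≡ x - (x - + 1) - + 1
      window-at = solve-∀
      window-above₁ : ∀ x hi → x - hi - + 1 + + 1 ≡ x - (hi - + 1) - + 1
      window-above₁ = solve-∀

    window : ∀ lo hi x → Nonneg (hi - lo) →
      ⟦ lo ≤ x ⟧ * ⟦ x ≤ hi - + 1 ⟧ ≡ ⟦ lo ≤ x ⟧ - ⟦ hi + + 1 ≤ x ⟧ - ⟦ x ≡ hi ⟧
    window lo hi x lo≤hi with ≤-or-> lo x
    ... | inj₂ x<lo rewrite ⟦≤⟧-zero {lo} {x} x<lo
                          | ⟦≤⟧-zero {hi + + 1} {x} (cast (nonneg-+ (nonneg-+ x<lo lo≤hi) (nonneg-ℕ 1)) (window-below₁ lo hi x))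
                          | ⟦≡⟧-zero< {x} {hi} (cast (nonneg-+ x<lo lo≤hi) (window-below₂ lo hi x)) = refl
    ... | inj₁ lo≤x with trichotomy x hi
    ...   | inj₁ x<hi rewrite ⟦≤⟧-one {lo} {x} lo≤x | ⟦≤⟧-one {x} {hi - + 1} (cast x<hi (window-inside₁ x hi))
                            | ⟦≤⟧-zero {hi + + 1} {x} (cast (nonneg-+ x<hi (nonneg-ℕ 1)) (window-inside₂ x hi))
                            | ⟦≡⟧-zero< {x} {hi} x<hi = refl
    ...   | inj₂ (inj₁ refl) rewrite ⟦≤⟧-one {lo} {x} lo≤x | ⟦≤⟧-zero {x} {x - + 1} (cast (nonneg-ℕ 0) (window-at x))
                                   | ⟦≤⟧-zero {x + + 1} {x} (cast (nonneg-ℕ 0) (split-at x)) | ⟦≡⟧-one {x} {x} refl = refl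
    ...   | inj₂ (inj₂ x>hi) rewrite ⟦≤⟧-one {lo} {x} lo≤x
                                   | ⟦≤⟧-zero {x} {hi - + 1} (cast (nonneg-+ x>hi (nonneg-ℕ 1)) (window-above₁ x hi))
                                   | ⟦≤⟧-one {hi + + 1} {x} (cast x>hi (split-above₂ hi x)) | ⟦≡⟧-zero> {x} {hi} x>hi = refl

    module _ (k : ℤ) (k≥1 : Nonneg (k - + 1)) where
      private
        0<k : + 0 < k
        0<k = nonneg⇒< (cast k≥1 (cong (_- + 1) (sym (ℤP.+-identityʳ k))))
        instance
          k-positive : ℤ.Positive k
          k-positive = ℤ.positive 0<k
          k-nonzero : ℤ.NonZero k
          k-nonzero = ℤ.>-nonZero 0<k
          k-nonnegative : ℤ.NonNegative k
          k-nonnegative = ℤ.nonNegative (ℤP.<⇒≤ 0<k)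

      ⟦<⟧-scale : ∀ x y → ⟦ k * x < k * y ⟧ ≡ ⟦ x < y ⟧
      ⟦<⟧-scale x y = cong ⌊_⌋ (does-⇔ ((k * x) <? (k * y)) (x <? y) (ℤP.*-cancelˡ-<-nonNeg k) (ℤP.*-monoˡ-<-pos k))

      ⟦≤⟧-scale : ∀ x y → ⟦ k * x ≤ k * y ⟧ ≡ ⟦ x ≤ y ⟧
      ⟦≤⟧-scale x y = cong ⌊_⌋ (does-⇔ ((k * x) ≤? (k * y)) (x ≤? y) (ℤP.*-cancelˡ-≤-pos x y k) (ℤP.*-monoˡ-≤-nonNeg k))

      ⟦≡⟧-scale : ∀ x y → ⟦ k * x ≡ k * y ⟧ ≡ ⟦ x ≡ y ⟧
      ⟦≡⟧-scale x y = cong ⌊_⌋ (does-⇔ ((k * x) ≟ (k * y)) (x ≟ y) (ℤP.*-cancelˡ-≡ k x y) (cong (k *_)))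

    hook : ∀ p q i j → ⟦ p ≤ i ⟧ * ⟦ q ≤ j ⟧ - ⟦ p + + 1 ≤ i ⟧ * ⟦ q + + 1 ≤ j ⟧
                       ≡ ⟦ p ≤ i ⟧ * ⟦ j ≡ q ⟧ + ⟦ i ≡ p ⟧ * ⟦ q ≤ j ⟧ - ⟦ i ≡ p ⟧ * ⟦ j ≡ q ⟧
    hook p q i j = expand {x = ⟦ p + + 1 ≤ i ⟧} {⟦ i ≡ p ⟧} {y = ⟦ q + + 1 ≤ j ⟧} {⟦ j ≡ q ⟧} (⟦≤⟧-split p i) (⟦≤⟧-split q j)
      where
      identity : ∀ x e y f → (x + e) * (y + f) - x * y ≡ (x + e) * f + e * (y + f) - e * f
      identity = solve-∀
      expand : ∀ {X x e Y y f} → X ≡ x + e → Y ≡ y + f → X * Y - x * y ≡ X * f + e * Y - e * f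
      expand {x = x} {e} {y = y} {f} refl refl = identity x e y f

  open Brackets

  module LaurentCoefficients where
    open import Data.Bool using (true; false; if_then_else_; _∧_)
    open import Data.List using ([]; _∷_; map)

    δ : Mono → ℤ → ℤ → ℤ
    δ (i , j) k l = ⟦ i ≡ k ⟧ * ⟦ j ≡ l ⟧

    coeff-∷ : ∀ c m p k l → coeff ((c , m) ∷ p) (k , l) ≡ c * δ m k l + coeff p (k , l)
    coeff-∷ c (i , j) p k l = cong (_+ coeff p (k , l)) (select (does (i ≟ k)) (does (j ≟ l)))
      where
      select : ∀ s t → (if s ∧ t then c else + 0) ≡ c * (⌊ s ⌋ * ⌊ t ⌋)
      select true true = sym (ℤP.*-identityʳ c)
      select true false = sym (ℤP.*-zeroʳ c)
      select false t = sym (ℤP.*-zeroʳ c)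

    coeff-+ : ∀ p q m → coeff (p +L q) m ≡ coeff p m + coeff q m
    coeff-+ [] q m = sym (ℤP.+-identityˡ _)
    coeff-+ ((c , (i , j)) ∷ p) q (k , l) =
      trans (cong (λ w → hit + w) (coeff-+ p q (k , l))) (sym (ℤP.+-assoc hit (coeff p (k , l)) (coeff q (k , l))))
      where hit = if does (i ≟ k) ∧ does (j ≟ l) then c else + 0

    -- The coefficient of a product is the convolution of the coefficients; the
    -- first factor is kept as a list of terms, so for an explicit prefactor the
    -- convolution unfolds to a finite signed sum of shifted coefficients.
    _-m_ : Mono → Mono → Mono
    (k , l) -m (i , j) = (k - i , l - j)

    convolution : LPoly → LPoly → Mono → ℤ
    convolution [] q m = + 0
    convolution ((c , n) ∷ p) q m = c * coeff q (m -m n) + convolution p q m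

    private
      does-shift : ∀ n i k → does ((n + i) ≟ k) ≡ does (i ≟ (k - n))
      does-shift n i k = does-⇔ ((n + i) ≟ k) (i ≟ (k - n))
        (λ e → trans (cancel₁ n i) (cong (_- n) e)) (λ e → trans (cong (λ w → n + w) e) (cancel₂ n k))
        where cancel₁ : ∀ n i → i ≡ n + i - n
              cancel₁ = solve-∀
              cancel₂ : ∀ n k → n + (k - n) ≡ k
              cancel₂ = solve-∀

      scale-if : ∀ s c c' → (if s then c * c' else + 0) ≡ c * (if s then c' else + 0)
      scale-if true c c' = refl
      scale-if false c c' = sym (ℤP.*-zeroʳ c)

    coeff-scaled-shift : ∀ c n q m →
      coeff (map (λ { (c' , m') → c * c' , (n ·m m') }) q) m ≡ c * coeff q (m -m n)
    coeff-scaled-shift c n [] m = sym (ℤP.*-zeroʳ c)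
    coeff-scaled-shift c (n₁ , n₂) ((c' , (i , j)) ∷ q) (k , l) =
      trans (cong₂ _+_ (trans (cong₂ (λ s t → if s ∧ t then c * c' else + 0) (does-shift n₁ i k) (does-shift n₂ j l))
                              (scale-if (does (i ≟ (k - n₁)) ∧ does (j ≟ (l - n₂))) c c'))
                       (coeff-scaled-shift c (n₁ , n₂) q (k , l)))
            (sym (ℤP.*-distribˡ-+ c (if does (i ≟ (k - n₁)) ∧ does (j ≟ (l - n₂)) then c' else + 0) (coeff q (k - n₁ , l - n₂))))

    coeff-* : ∀ p q m → coeff (p *L q) m ≡ convolution p q m
    coeff-* [] q m = refl
    coeff-* ((c , n) ∷ p) q m =
      trans (coeff-+ (map (λ { (c' , m') → c * c' , (n ·m m') }) q) (p *L q) m)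
            (cong₂ _+_ (coeff-scaled-shift c n q m) (coeff-* p q m))

    ∇ : (ℤ → ℤ → ℤ) → ℤ → ℤ → ℤ
    ∇ F k l = F k l - F (k - + 1) l - F k (l - + 1) + F (k - + 1) (l - + 1)

    ∇-cong : ∀ {F G} → (∀ i j → F i j ≡ G i j) → ∀ k l → ∇ F k l ≡ ∇ G k l
    ∇-cong F≡G k l = cong₂ _+_ (cong₂ _-_ (cong₂ _-_ (F≡G k l) (F≡G (k - + 1) l)) (F≡G k (l - + 1))) (F≡G (k - + 1) (l - + 1))

    ∇-+ : ∀ F G k l → ∇ (λ i j → F i j + G i j) k l ≡ ∇ F k l + ∇ G k l
    ∇-+ F G k l = linear (F k l) (F (k - + 1) l) (F k (l - + 1)) (F (k - + 1) (l - + 1))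
                         (G k l) (G (k - + 1) l) (G k (l - + 1)) (G (k - + 1) (l - + 1))
      where linear : ∀ f₁ f₂ f₃ f₄ g₁ g₂ g₃ g₄ →
                       f₁ + g₁ - (f₂ + g₂) - (f₃ + g₃) + (f₄ + g₄) ≡ (f₁ - f₂ - f₃ + f₄) + (g₁ - g₂ - g₃ + g₄)
            linear = solve-∀

    quadrant : Mono → ℤ → ℤ → ℤ
    quadrant (p , q) i j = ⟦ p ≤ i ⟧ * ⟦ q ≤ j ⟧

    quadrant-row : ∀ p q i j → quadrant (p , q) i j - quadrant (p , q + + 1) i j ≡ ⟦ p ≤ i ⟧ * ⟦ j ≡ q ⟧
    quadrant-row p q i j = difference (⟦≤⟧-split q j)
      where
      cancel : ∀ x y e → x * (y + e) - x * y ≡ x * e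
      cancel = solve-∀
      difference : ∀ {Y} → Y ≡ ⟦ q + + 1 ≤ j ⟧ + ⟦ j ≡ q ⟧ → ⟦ p ≤ i ⟧ * Y - ⟦ p ≤ i ⟧ * ⟦ q + + 1 ≤ j ⟧ ≡ ⟦ p ≤ i ⟧ * ⟦ j ≡ q ⟧
      difference refl = cancel ⟦ p ≤ i ⟧ ⟦ q + + 1 ≤ j ⟧ ⟦ j ≡ q ⟧

    quadrant-column : ∀ p q i j → quadrant (p , q) i j - quadrant (p + + 1 , q) i j ≡ ⟦ i ≡ p ⟧ * ⟦ q ≤ j ⟧
    quadrant-column p q i j = difference (⟦≤⟧-split p i)
      where
      cancel : ∀ x e y → (x + e) * y - x * y ≡ e * y
      cancel = solve-∀
      difference : ∀ {X} → X ≡ ⟦ p + + 1 ≤ i ⟧ + ⟦ i ≡ p ⟧ → X * ⟦ q ≤ j ⟧ - ⟦ p + + 1 ≤ i ⟧ * ⟦ q ≤ j ⟧ ≡ ⟦ i ≡ p ⟧ * ⟦ q ≤ j ⟧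
      difference refl = cancel ⟦ p + + 1 ≤ i ⟧ ⟦ i ≡ p ⟧ ⟦ q ≤ j ⟧

    quadrant-translate : ∀ p q i j → quadrant (+ 1 , + 1) (i - p) (j - q) ≡ quadrant (p + + 1 , q + + 1) i j
    quadrant-translate p q i j = cong₂ _*_ (⟦≤⟧-shift {+ 1} {i - p} {p + + 1} {i} (shift i p)) (⟦≤⟧-shift {+ 1} {j - q} {q + + 1} {j} (shift j q))
      where shift : ∀ i p → i - p - + 1 ≡ i - (p + + 1)
            shift = solve-∀

    -- Summing the quadrants of all terms gives the cumulative function of a
    -- Laurent polynomial, whose mixed difference recovers the coefficients.
    cumulative : LPoly → ℤ → ℤ → ℤ
    cumulative [] i j = + 0
    cumulative ((c , m) ∷ p) i j = c * quadrant m i j + cumulative p i j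

    ∇-quadrant : ∀ m k l → ∇ (quadrant m) k l ≡ δ m k l
    ∇-quadrant (p , q) k l =
      trans (cong₂ (λ x y → ⟦ p ≤ k ⟧ * ⟦ q ≤ l ⟧ - x * ⟦ q ≤ l ⟧ - ⟦ p ≤ k ⟧ * y + x * y)
                   (⟦≤⟧-shift {p} {k - + 1} {p + + 1} {k} (step k p)) (⟦≤⟧-shift {q} {l - + 1} {q + + 1} {l} (step l q)))
      (trans (product-difference {x = ⟦ p + + 1 ≤ k ⟧} {⟦ k ≡ p ⟧} {y = ⟦ q + + 1 ≤ l ⟧} {⟦ l ≡ q ⟧} (⟦≤⟧-split p k) (⟦≤⟧-split q l))
             (cong₂ _*_ (⟦≡⟧-sym k p) (⟦≡⟧-sym l q)))
      where
      step : ∀ k p → k - + 1 - p ≡ k - (p + + 1)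
      step = solve-∀
      expand : ∀ x e y f → (x + e) * (y + f) - x * (y + f) - (x + e) * y + x * y ≡ e * f
      expand = solve-∀
      product-difference : ∀ {X x e Y y f} → X ≡ x + e → Y ≡ y + f → X * Y - x * Y - X * y + x * y ≡ e * f
      product-difference {x = x} {e} {y = y} {f} refl refl = expand x e y f

    ∇-scaled-sum : ∀ c F G k l → ∇ (λ i j → c * F i j + G i j) k l ≡ c * ∇ F k l + ∇ G k l
    ∇-scaled-sum c F G k l = linear c (F k l) (F (k - + 1) l) (F k (l - + 1)) (F (k - + 1) (l - + 1))
                                      (G k l) (G (k - + 1) l) (G k (l - + 1)) (G (k - + 1) (l - + 1))
      where linear : ∀ c f₁ f₂ f₃ f₄ g₁ g₂ g₃ g₄ →
                       c * f₁ + g₁ - (c * f₂ + g₂) - (c * f₃ + g₃) + (c * f₄ + g₄)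
                       ≡ c * (f₁ - f₂ - f₃ + f₄) + (g₁ - g₂ - g₃ + g₄)
            linear = solve-∀

    coeff-as-∇ : ∀ p k l → coeff p (k , l) ≡ ∇ (cumulative p) k l
    coeff-as-∇ [] k l = refl
    coeff-as-∇ ((c , m) ∷ p) k l = begin
      coeff ((c , m) ∷ p) (k , l)                       ≡⟨ coeff-∷ c m p k l ⟩
      c * δ m k l + coeff p (k , l)                      ≡⟨ cong₂ (λ x y → c * x + y) (sym (∇-quadrant m k l)) (coeff-as-∇ p k l) ⟩
      c * ∇ (quadrant m) k l + ∇ (cumulative p) k l      ≡⟨ sym (∇-scaled-sum c (quadrant m) (cumulative p) k l) ⟩
      ∇ (cumulative ((c , m) ∷ p)) k l                   ∎
      where open ≡-Reasoning

  open LaurentCoefficients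

  module DedekindCarlitzCoefficients where
    import Data.Nat.DivMod as ℕD
    import Data.Nat.Properties as ℕP
    open import Data.List using ([])

    private
      pos-expand : ∀ r q β → + (r ℕ.+ q ℕ.* β) ≡ + r + + q * + β
      pos-expand r q β = trans (ℤP.pos-+ r (q ℕ.* β)) (cong (λ w → + r + w) (ℤP.pos-* q β))

      neg-expand : ∀ n → -[1+ n ] ≡ - (+ n) - + 1
      neg-expand n = trans (ℤP.neg-suc n) (ℤP.+-comm -[1+ 0 ] (- (+ n)))

      lower₊ : ∀ r q β → r + q * β - β * q ≡ r
      lower₊ = solve-∀
      upper₊ : ∀ r q β → β * (q + + 1) - (r + q * β) - + 1 ≡ β - (+ 1 + r)
      upper₊ = solve-∀
      lower₋ : ∀ r q β → - (r + q * β) - + 1 - β * (- q - + 1) ≡ β - r - + 1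
      lower₋ = solve-∀
      upper₋ : ∀ r q β → β * (- q - + 1 + + 1) - (- (r + q * β) - + 1) - + 1 ≡ r
      upper₋ = solve-∀

    floor-bounds : ∀ (N : ℤ) (β : ℕ) .{{_ : ℕ.NonZero β}} →
      Nonneg (N - + β * floorDiv N β) × Nonneg (+ β * (floorDiv N β + + 1) - N - + 1)
    floor-bounds (+ n) β =
        cast (nonneg-ℕ r) (sym (trans (cong (λ w → w - + β * + q) division) (lower₊ (+ r) (+ q) (+ β))))
      , cast (≤⇒nonneg (ℤ.+≤+ (ℕD.m%n<n n β)))
             (sym (trans (cong (λ w → + β * (+ q + + 1) - w - + 1) division)
                         (trans (upper₊ (+ r) (+ q) (+ β)) (cong (λ w → + β - w) (sym (ℤP.pos-+ 1 r))))))
      where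
      q = n ℕD./ β
      r = n ℕD.% β
      division : + n ≡ + r + + q * + β
      division = trans (cong +_ (ℕD.m≡m%n+[m/n]*n n β)) (pos-expand r q β)
    floor-bounds -[1+ n ] β =
        cast (<⇒nonneg (ℤ.+<+ (ℕD.m%n<n n β)))
             (sym (trans (cong₂ (λ x w → x - + β * w) division (neg-expand q)) (lower₋ (+ r) (+ q) (+ β))))
      , cast (nonneg-ℕ r)
             (sym (trans (cong₂ (λ x w → + β * (w + + 1) - x - + 1) division (neg-expand q)) (upper₋ (+ r) (+ q) (+ β))))
      where
      q = n ℕD./ β
      r = n ℕD.% β
      division : -[1+ n ] ≡ - (+ r + + q * + β) - + 1
      division = trans (neg-expand n) (cong (λ w → - w - + 1) (trans (cong +_ (ℕD.m≡m%n+[m/n]*n n β)) (pos-expand r q β)))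

    private
      floor-below₁ : ∀ β P f N → β * (P - f - + 1) + (β * (f + + 1) - N - + 1) ≡ β * P - N - + 1
      floor-below₁ = solve-∀
      floor-below₂ : ∀ β P f N → β * (P - f - + 1) + (β * (f + + 1) - N - + 1) + β ≡ β * (P + + 1) - N - + 1
      floor-below₂ = solve-∀
      floor-above₁ : ∀ β P f N → N - β * f + β * (f - P - + 1) ≡ N - β * (P + + 1)
      floor-above₁ = solve-∀
      floor-above₂ : ∀ β P f N → N - β * f + β * (f - P - + 1) + β ≡ N - β * P
      floor-above₂ = solve-∀

    ⟦floor≡⟧ : ∀ (N : ℤ) (β : ℕ) .{{_ : ℕ.NonZero β}} (P : ℤ) →
      ⟦ floorDiv N β ≡ P ⟧ ≡ ⟦ N < + β * (P + + 1) ⟧ - ⟦ N < + β * P ⟧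
    ⟦floor≡⟧ N β P with trichotomy (floorDiv N β) P | floor-bounds N β
    ... | inj₁ f<P | lo , hi =
      trans (⟦≡⟧-zero< {floorDiv N β} {P} f<P) (sym (cong₂ _-_
        (⟦<⟧-one {N} {+ β * (P + + 1)} (cast (nonneg-+ (nonneg-+ (nonneg-* (nonneg-ℕ β) f<P) hi) (nonneg-ℕ β)) (floor-below₂ (+ β) P f N)))
        (⟦<⟧-one {N} {+ β * P} (cast (nonneg-+ (nonneg-* (nonneg-ℕ β) f<P) hi) (floor-below₁ (+ β) P f N)))))
      where f = floorDiv N β
    ... | inj₂ (inj₁ refl) | lo , hi =
      trans (⟦≡⟧-one {floorDiv N β} refl) (sym (cong₂ _-_ (⟦<⟧-one {N} hi) (⟦<⟧-zero {N} lo)))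
    ... | inj₂ (inj₂ f>P) | lo , hi =
      trans (⟦≡⟧-zero> {floorDiv N β} {P} f>P) (sym (cong₂ _-_
        (⟦<⟧-zero {N} {+ β * (P + + 1)} (cast (nonneg-+ lo (nonneg-* (nonneg-ℕ β) f>P)) (floor-above₁ (+ β) P f N)))
        (⟦<⟧-zero {N} {+ β * P} (cast (nonneg-+ (nonneg-+ lo (nonneg-* (nonneg-ℕ β) f>P)) (nonneg-ℕ β)) (floor-above₂ (+ β) P f N)))))
      where f = floorDiv N β

    summand : (e f : Mono) (α : ℤ) (β : ℕ) .{{_ : ℕ.NonZero β}} → ℕ → Mono
    summand e f α β k = (e ^m floorDiv (+ (suc k) * α) β) ·m (f ^m (+ k))

    coeff-mono : ∀ m k l → coeff (mono m) (k , l) ≡ δ m k l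
    coeff-mono m k l = trans (coeff-∷ (+ 1) m [] k l) (unit (δ m k l))
      where unit : ∀ x → + 1 * x + + 0 ≡ x
            unit = solve-∀

    private
      next-value : ∀ k → + 0 ≡ + 1 + k - k - + 1
      next-value = solve-∀

    range-step : ∀ Q K → ⟦ + 0 ≤ Q ⟧ * ⟦ Q < + suc K ⟧ ≡ ⟦ + 0 ≤ Q ⟧ * ⟦ Q < + K ⟧ + ⟦ + K ≡ Q ⟧
    range-step Q K with Q ≟ + K
    ... | yes refl rewrite ⟦≤⟧-one {+ 0} {+ K} (cast (nonneg-ℕ K) (sym (ℤP.+-identityʳ (+ K))))
                         | ⟦<⟧-one {+ K} {+ suc K} (cast (nonneg-ℕ 0) (trans (next-value (+ K)) (cong (λ w → w - + K - + 1) (sym (ℤP.pos-+ 1 K)))))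
                         | ⟦<⟧-zero {+ K} {+ K} (cast (nonneg-ℕ 0) (sym (ℤP.+-inverseʳ (+ K))))
                         | ⟦≡⟧-one {+ K} {+ K} refl = refl
    ... | no Q≢K = trans (cong (⟦ + 0 ≤ Q ⟧ *_) (sym same-bracket))
                         (sym (trans (cong (λ w → ⟦ + 0 ≤ Q ⟧ * ⟦ Q < + K ⟧ + w) (⟦≡⟧-zero (λ e → Q≢K (sym e))))
                                     (ℤP.+-identityʳ _)))
      where
      same-bracket : ⟦ Q < + K ⟧ ≡ ⟦ Q < + suc K ⟧
      same-bracket = cong ⌊_⌋ (does-⇔ (Q ℤP.<? + K) (Q ℤP.<? + suc K)
        (λ p → ℤP.<-trans p (ℤ.+<+ (ℕP.n<1+n K)))
        (λ p → ℤP.≤∧≢⇒< (nonneg⇒≤ (cast (<⇒nonneg p) (previous Q K))) Q≢K))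
        where previous : ∀ Q K → + suc K - Q - + 1 ≡ + K - Q
              previous Q K = trans (cong (λ w → w - Q - + 1) (ℤP.pos-+ 1 K)) (cancel Q (+ K))
                where cancel : ∀ Q x → + 1 + x - Q - + 1 ≡ x - Q
                      cancel = solve-∀

    ⟦≡⟧-substitute : ∀ (B : ℤ → ℤ) x y → ⟦ x ≡ y ⟧ * B x ≡ ⟦ x ≡ y ⟧ * B y
    ⟦≡⟧-substitute B x y with x ≟ y
    ... | yes refl = refl
    ... | no _ = refl

    dcSum-coeff : ∀ (e f : Mono) (α : ℤ) (β : ℕ) .{{_ : ℕ.NonZero β}} (m : Mono) (Q : ℤ) (B : ℤ → ℤ) →
      (∀ k → coeff (mono (summand e f α β k)) m ≡ ⟦ + k ≡ Q ⟧ * B (+ k)) →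
      ∀ K → coeff (dcSum e f α β K) m ≡ ⟦ + 0 ≤ Q ⟧ * ⟦ Q < + K ⟧ * B Q
    dcSum-coeff e f α β m Q B hit zero with ≤-or-> (+ 0) Q
    ... | inj₁ 0≤Q rewrite ⟦<⟧-zero {Q} {+ 0} 0≤Q =
      cong (_* B Q) (sym (ℤP.*-zeroʳ ⟦ + 0 ≤ Q ⟧))
    ... | inj₂ Q<0 rewrite ⟦≤⟧-zero {+ 0} {Q} Q<0 = refl
    dcSum-coeff e f α β m Q B hit (suc K) = begin
      coeff (dcSum e f α β K +L mono (summand e f α β K)) m
        ≡⟨ coeff-+ (dcSum e f α β K) (mono (summand e f α β K)) m ⟩
      coeff (dcSum e f α β K) m + coeff (mono (summand e f α β K)) m
        ≡⟨ cong₂ _+_ (dcSum-coeff e f α β m Q B hit K) (trans (hit K) (⟦≡⟧-substitute B (+ K) Q)) ⟩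
      ⟦ + 0 ≤ Q ⟧ * ⟦ Q < + K ⟧ * B Q + ⟦ + K ≡ Q ⟧ * B Q
        ≡⟨ sym (ℤP.*-distribʳ-+ (B Q) (⟦ + 0 ≤ Q ⟧ * ⟦ Q < + K ⟧) ⟦ + K ≡ Q ⟧) ⟩
      (⟦ + 0 ≤ Q ⟧ * ⟦ Q < + K ⟧ + ⟦ + K ≡ Q ⟧) * B Q
        ≡⟨ cong (_* B Q) (sym (range-step Q K)) ⟩
      ⟦ + 0 ≤ Q ⟧ * ⟦ Q < + suc K ⟧ * B Q ∎
      where open ≡-Reasoning

    -- Coefficients of the Dedekind–Carlitz polynomial c(u^e₁ v^e₂, u^f₁ v^f₂; α, β)
    -- when (e₁ , e₂), (f₁ , f₂) form a lattice basis, so that (I , J) = p e + q f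
    -- in a unique way: the coefficient is [0 ≤ q < β - 1] [⌊(q+1) α / β⌋ = p].
    DC-coeff : ∀ (e₁ e₂ f₁ f₂ α : ℤ) (β : ℕ) .{{_ : ℕ.NonZero β}} (I J p q : ℤ) →
      p * e₁ + q * f₁ ≡ I → p * e₂ + q * f₂ ≡ J →
      (∀ F k → F * e₁ + k * f₁ ≡ I → F * e₂ + k * f₂ ≡ J → k ≡ q × F ≡ p) →
      coeff (DC (e₁ , e₂) (f₁ , f₂) α β) (I , J) ≡
        ⟦ + 0 ≤ q ⟧ * ⟦ q < + β - + 1 ⟧ * (⟦ (q + + 1) * α < + β * (p + + 1) ⟧ - ⟦ (q + + 1) * α < + β * p ⟧)
    DC-coeff e₁ e₂ f₁ f₂ α β I J p q at-I at-J unique =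
      trans (dcSum-coeff (e₁ , e₂) (f₁ , f₂) α β (I , J) q (λ k → ⟦ floorDiv ((k + + 1) * α) β ≡ p ⟧) hit (β ℕ.∸ 1))
            (cong₂ (λ n x → ⟦ + 0 ≤ q ⟧ * ⟦ q < n ⟧ * x) (predecessor β) (⟦floor≡⟧ ((q + + 1) * α) β p))
      where
      predecessor : ∀ β .{{_ : ℕ.NonZero β}} → + (β ℕ.∸ 1) ≡ + β - + 1
      predecessor (suc β) = refl
      -- The k-th summand is F e + k f with F = ⌊(k+1) α / β⌋; it is (I , J)
      -- exactly when (k , F) are the coordinates (q , p).
      hit : ∀ k → coeff (mono (summand (e₁ , e₂) (f₁ , f₂) α β k)) (I , J)
                ≡ ⟦ + k ≡ q ⟧ * ⟦ floorDiv ((+ k + + 1) * α) β ≡ p ⟧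
      hit k = trans (coeff-mono (summand (e₁ , e₂) (f₁ , f₂) α β k) I J)
        (trans (cong (λ s → ⟦ floorDiv (s * α) β * e₁ + + k * f₁ ≡ I ⟧ * ⟦ floorDiv (s * α) β * e₂ + + k * f₂ ≡ J ⟧) suc-k)
               (trans (sym (⌊∧⌋ (does (F * e₁ + + k * f₁ ≟ I)) (does (F * e₂ + + k * f₂ ≟ J))))
               (trans (cong ⌊_⌋ (does-⇔ ((F * e₁ + + k * f₁ ≟ I) ×-dec (F * e₂ + + k * f₂ ≟ J)) ((+ k ≟ q) ×-dec (F ≟ p))
                         (λ (x , y) → unique F (+ k) x y)
                         (λ (k≡q , F≡p) → reconstruct k≡q F≡p)))
                      (⌊∧⌋ (does (+ k ≟ q)) (does (F ≟ p))))))
        where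
        F = floorDiv ((+ k + + 1) * α) β
        reconstruct : + k ≡ q → F ≡ p → F * e₁ + + k * f₁ ≡ I × F * e₂ + + k * f₂ ≡ J
        reconstruct refl refl = at-I , at-J
        suc-k : + suc k ≡ + k + + 1
        suc-k = trans (ℤP.pos-+ 1 k) (ℤP.+-comm (+ 1) (+ k))

  open DedekindCarlitzCoefficients

  module PrimitiveSegment where
    open import Data.Nat.Coprimality using (gcd≡1⇒coprime; coprime-divisor)
    import Data.Nat.Coprimality as Coprimality
    open import Data.Nat.Divisibility using (_∣_; divides; ∣⇒≤)
    import Data.Nat.Properties as ℕP

    primitive-segmentℕ : ∀ p q I J → gcd p q ≡ 1 → 0 ℕ.< q → p ℕ.* J ≡ q ℕ.* I → 1 ℕ.≤ J → J ℕ.≤ q →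
      I ≡ p × J ≡ q
    primitive-segmentℕ p q I J coprime 0<q pJ≡qI 1≤J J≤q = I≡p , J≡q
      where
      q∣J : q ∣ J
      q∣J = coprime-divisor {q} {p} {J} (Coprimality.sym {p} {q} (gcd≡1⇒coprime {p} {q} coprime))
                            (divides I (trans pJ≡qI (ℕP.*-comm q I)))
      J≡q : J ≡ q
      J≡q = ℕP.≤-antisym J≤q (∣⇒≤ {{ℕ.>-nonZero 1≤J}} q∣J)
      I≡p : I ≡ p
      I≡p = ℕP.*-cancelˡ-≡ I p q {{ℕ.>-nonZero 0<q}} (trans (sym pJ≡qI) (trans (cong (p ℕ.*_) J≡q) (ℕP.*-comm p q)))

    private
      difference-zero : ∀ {x y} → x - y ≡ + 0 → x ≡ y
      difference-zero {x} {y} e = trans (sym (cancel x y)) (trans (cong (_+ y) e) (ℤP.+-identityˡ y))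
        where cancel : ∀ x y → x - y + y ≡ x
              cancel = solve-∀
      positive-multiple : ∀ P Q u v → (P - + 1 + + 1) * (v - + 1) + (P - + 1) ≡ Q * u - + 1 + (P * v - Q * u)
      positive-multiple = solve-∀

    primitive-segment : ∀ (p q : ℕ) → 0 ℕ.< p → 0 ℕ.< q → gcd p q ≡ 1 →
      ∀ u v → + p * v - + q * u ≡ + 0 → + 1 ≤ v → v ≤ + q → u ≡ + p × v ≡ + q
    primitive-segment p q 0<p 0<q coprime u (+ V) on-line (ℤ.+≤+ 1≤V) (ℤ.+≤+ V≤q) =
      point u u-positive on-line
      where
      u-positive : Nonneg (u - + 1)
      u-positive = positive-factor {+ q} {u} (≤⇒nonneg (ℤ.+≤+ 0<q))
        (cast (nonneg-+ (nonneg-* (nonneg-+ (≤⇒nonneg (ℤ.+≤+ 0<p)) (nonneg-ℕ 1)) (≤⇒nonneg (ℤ.+≤+ 1≤V))) (≤⇒nonneg (ℤ.+≤+ 0<p)))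
              (trans (positive-multiple (+ p) (+ q) u (+ V)) (trans (cong (λ w → + q * u - + 1 + w) on-line) (ℤP.+-identityʳ _))))
      point : ∀ u → Nonneg (u - + 1) → + p * + V - + q * u ≡ + 0 → u ≡ + p × + V ≡ + q
      point (+ U) _ on-line' with primitive-segmentℕ p q U V coprime 0<q
          (ℤP.+-injective (trans (ℤP.pos-* p V) (trans (difference-zero on-line') (sym (ℤP.pos-* q U))))) 1≤V V≤q
      ... | U≡p , V≡q = cong +_ U≡p , cong +_ V≡q

  open PrimitiveSegment

  module LineGeometry (a b c d : ℤ) (a≥1 : Nonneg (a - + 1)) (b≥1 : Nonneg (b - + 1))
    (segment : ∀ i j → a * j - b * i ≡ + 0 → Nonneg (j - + 1) → Nonneg (b - j) → i ≡ a × j ≡ b) where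

    -- Position relative to the line through 0 and (a , b): s < 0 below it.
    s : ℤ → ℤ → ℤ
    s i j = a * j - b * i

    Δ : ℤ
    Δ = a * d - b * c

    □ : (ℤ → ℤ → ℤ) → ℤ → ℤ → ℤ
    □ F i j = F i j - F (i - a) (j - b) - F (i - c) (j - d) + F (i - a - c) (j - b - d)

    below : ℤ → ℤ → ℤ
    below i j = ⟦ s i j ≤ + 0 ⟧ * ⟦ + 1 ≤ j ⟧

    strip : ℤ → ℤ → ℤ
    strip i j = ⟦ + 1 ≤ j ⟧ * ⟦ j ≤ b - + 1 ⟧ * ⟦ s i j < + 0 ⟧

    private
      along : ∀ a b i j → a * (j - b) - b * (i - a) ≡ a * j - b * i
      along = solve-∀
      up-to : ∀ a b i j → + 0 - (a * j - b * i) + (a - + 1 + + 1) * (j - + 1) + (a - + 1) ≡ b * i - + 1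
      up-to = solve-∀
      on-row-value : ∀ a b i → a * b - b * i ≡ b * (a - i)
      on-row-value = solve-∀

    below-line-positive : ∀ i j → Nonneg (+ 0 - s i j) → Nonneg (j - + 1) → Nonneg (i - + 1)
    below-line-positive i j s≤0 j≥1 = positive-factor {b} {i} b≥1
      (cast (nonneg-+ (nonneg-+ s≤0 (nonneg-* (nonneg-+ a≥1 (nonneg-ℕ 1)) j≥1)) a≥1) (up-to a b i j))

    on-row : ∀ (B : ℤ → ℤ) i j → B (s i j) * ⟦ j ≡ b ⟧ ≡ B (b * (a - i)) * ⟦ j ≡ b ⟧
    on-row B i j with j ≟ b
    ... | yes refl = cong (λ x → B x * + 1) (on-row-value a b i)
    ... | no _ = trans (ℤP.*-zeroʳ (B (s i j))) (sym (ℤP.*-zeroʳ (B (b * (a - i)))))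

    on-row-≤ : ∀ i j → ⟦ s i j ≤ + 0 ⟧ * ⟦ j ≡ b ⟧ ≡ ⟦ a ≤ i ⟧ * ⟦ j ≡ b ⟧
    on-row-≤ i j = trans (on-row (λ x → ⟦ x ≤ + 0 ⟧) i j)
      (cong (_* ⟦ j ≡ b ⟧) (trans (⟦≤⟧-shift {b * (a - i)} {+ 0} {b * a} {b * i} (shift a b i)) (⟦≤⟧-scale b b≥1 a i)))
      where shift : ∀ a b i → + 0 - b * (a - i) ≡ b * i - b * a
            shift = solve-∀

    on-row-≡ : ∀ i j → ⟦ s i j ≡ + 0 ⟧ * ⟦ j ≡ b ⟧ ≡ ⟦ i ≡ a ⟧ * ⟦ j ≡ b ⟧
    on-row-≡ i j = trans (on-row (λ x → ⟦ x ≡ + 0 ⟧) i j)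
      (cong (_* ⟦ j ≡ b ⟧) (trans (⟦≡⟧-shift {b * (a - i)} {+ 0} {b * a} {b * i} (shift a b i))
                           (trans (⟦≡⟧-scale b b≥1 a i) (⟦≡⟧-sym a i))))
      where shift : ∀ a b i → + 0 - b * (a - i) ≡ b * i - b * a
            shift = solve-∀

    interior-empty : ∀ i j → ⟦ s i j ≡ + 0 ⟧ * (⟦ + 1 ≤ j ⟧ * ⟦ j ≤ b - + 1 ⟧) ≡ + 0
    interior-empty i j with s i j ≟ + 0
    ... | no _ = refl
    ... | yes on-line with ≤-or-> (+ 1) j | ≤-or-> j (b - + 1)
    ...   | inj₂ j<1 | _ = cong (λ x → + 1 * (x * ⟦ j ≤ b - + 1 ⟧)) (⟦≤⟧-zero {+ 1} {j} j<1)
    ...   | inj₁ _ | inj₂ j>b-1 = trans (cong (λ x → + 1 * (⟦ + 1 ≤ j ⟧ * x)) (⟦≤⟧-zero {j} {b - + 1} j>b-1))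
                                        (cong (+ 1 *_) (ℤP.*-zeroʳ ⟦ + 1 ≤ j ⟧))
    ...   | inj₁ j≥1 | inj₁ j≤b-1 with segment i j on-line j≥1 (cast (nonneg-+ j≤b-1 (nonneg-ℕ 1)) (step b j))
      where step : ∀ b j → b - + 1 - j + + 1 ≡ b - j
            step = solve-∀
    ...     | _ , refl = ⊥-elim (-1-negative (cast j≤b-1 (self j)))
      where self : ∀ j → j - + 1 - j ≡ -[1+ 0 ]
            self = solve-∀

    segment-count : ∀ i j → ⟦ s i j ≡ + 0 ⟧ * (⟦ + 1 ≤ j ⟧ - ⟦ b + + 1 ≤ j ⟧) ≡ ⟦ i ≡ a ⟧ * ⟦ j ≡ b ⟧
    segment-count i j = begin
      ⟦ s i j ≡ + 0 ⟧ * (⟦ + 1 ≤ j ⟧ - ⟦ b + + 1 ≤ j ⟧)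
        ≡⟨ cong (⟦ s i j ≡ + 0 ⟧ *_) (rows {L = ⟦ + 1 ≤ j ⟧} {⟦ b + + 1 ≤ j ⟧} (window (+ 1) b j b≥1)) ⟩
      ⟦ s i j ≡ + 0 ⟧ * (⟦ + 1 ≤ j ⟧ * ⟦ j ≤ b - + 1 ⟧ + ⟦ j ≡ b ⟧)
        ≡⟨ ℤP.*-distribˡ-+ ⟦ s i j ≡ + 0 ⟧ (⟦ + 1 ≤ j ⟧ * ⟦ j ≤ b - + 1 ⟧) ⟦ j ≡ b ⟧ ⟩
      ⟦ s i j ≡ + 0 ⟧ * (⟦ + 1 ≤ j ⟧ * ⟦ j ≤ b - + 1 ⟧) + ⟦ s i j ≡ + 0 ⟧ * ⟦ j ≡ b ⟧
        ≡⟨ cong₂ _+_ (interior-empty i j) (on-row-≡ i j) ⟩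
      + 0 + ⟦ i ≡ a ⟧ * ⟦ j ≡ b ⟧
        ≡⟨ ℤP.+-identityˡ _ ⟩
      ⟦ i ≡ a ⟧ * ⟦ j ≡ b ⟧ ∎
      where
      open ≡-Reasoning
      rows : ∀ {W L H E} → W ≡ L - H - E → L - H ≡ W + E
      rows {W} {L} {H} {E} refl = solve-rows L H E
        where solve-rows : ∀ L H E → L - H ≡ L - H - E + E
              solve-rows = solve-∀

    -- Inside the rows 1 ≤ j ≤ b - 1 being strictly right of the line is the same
    -- as being on or right of it, since the line meets no lattice point there.
    strip-weak : ∀ i j → strip i j ≡ ⟦ + 1 ≤ j ⟧ * ⟦ j ≤ b - + 1 ⟧ * ⟦ s i j ≤ + 0 ⟧
    strip-weak i j = sym (begin
      W * ⟦ s i j ≤ + 0 ⟧                         ≡⟨ cong (W *_) (⟦≤⟧-as-<+≡ (s i j) (+ 0)) ⟩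
      W * (⟦ s i j < + 0 ⟧ + ⟦ s i j ≡ + 0 ⟧)     ≡⟨ ℤP.*-distribˡ-+ W ⟦ s i j < + 0 ⟧ ⟦ s i j ≡ + 0 ⟧ ⟩
      W * ⟦ s i j < + 0 ⟧ + W * ⟦ s i j ≡ + 0 ⟧   ≡⟨ cong (λ x → W * ⟦ s i j < + 0 ⟧ + x) (trans (ℤP.*-comm W _) (interior-empty i j)) ⟩
      W * ⟦ s i j < + 0 ⟧ + + 0                   ≡⟨ ℤP.+-identityʳ _ ⟩
      strip i j                                   ∎)
      where
      open ≡-Reasoning
      W = ⟦ + 1 ≤ j ⟧ * ⟦ j ≤ b - + 1 ⟧

    strip-as-below : ∀ i j → strip i j ≡ below i j - below (i - a) (j - b) - ⟦ a ≤ i ⟧ * ⟦ j ≡ b ⟧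
    strip-as-below i j = begin
      strip i j
        ≡⟨ strip-weak i j ⟩
      ⟦ + 1 ≤ j ⟧ * ⟦ j ≤ b - + 1 ⟧ * ⟦ s i j ≤ + 0 ⟧
        ≡⟨ cong (_* ⟦ s i j ≤ + 0 ⟧) (window (+ 1) b j b≥1) ⟩
      (⟦ + 1 ≤ j ⟧ - ⟦ b + + 1 ≤ j ⟧ - ⟦ j ≡ b ⟧) * ⟦ s i j ≤ + 0 ⟧
        ≡⟨ distribute ⟦ + 1 ≤ j ⟧ ⟦ b + + 1 ≤ j ⟧ ⟦ j ≡ b ⟧ ⟦ s i j ≤ + 0 ⟧ ⟩
      below i j - ⟦ s i j ≤ + 0 ⟧ * ⟦ b + + 1 ≤ j ⟧ - ⟦ s i j ≤ + 0 ⟧ * ⟦ j ≡ b ⟧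
        ≡⟨ cong₂ (λ x y → below i j - x - y) (sym translate) (on-row-≤ i j) ⟩
      below i j - below (i - a) (j - b) - ⟦ a ≤ i ⟧ * ⟦ j ≡ b ⟧ ∎
      where
      open ≡-Reasoning
      distribute : ∀ L H E S → (L - H - E) * S ≡ S * L - S * H - S * E
      distribute = solve-∀
      translate : below (i - a) (j - b) ≡ ⟦ s i j ≤ + 0 ⟧ * ⟦ b + + 1 ≤ j ⟧
      translate = cong₂ _*_ (cong (λ x → ⟦ x ≤ + 0 ⟧) (along a b i j))
                            (⟦≤⟧-shift {+ 1} {j - b} {b + + 1} {j} (shift b j))
        where shift : ∀ b j → j - b - + 1 ≡ j - (b + + 1)
              shift = solve-∀

    strip-step : ∀ i j → strip i j - strip (i - c) (j - d)
      ≡ □ below i j - ⟦ a ≤ i ⟧ * ⟦ j ≡ b ⟧ + ⟦ a + c ≤ i ⟧ * ⟦ j ≡ b + d ⟧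
    strip-step i j = begin
      strip i j - strip (i - c) (j - d)
        ≡⟨ cong₂ _-_ (strip-as-below i j) (strip-as-below (i - c) (j - d)) ⟩
      (below i j - below (i - a) (j - b) - ⟦ a ≤ i ⟧ * ⟦ j ≡ b ⟧)
        - (below (i - c) (j - d) - below (i - c - a) (j - d - b) - ⟦ a ≤ i - c ⟧ * ⟦ j - d ≡ b ⟧)
        ≡⟨ cong₃ (λ x y z → (below i j - below (i - a) (j - b) - ⟦ a ≤ i ⟧ * ⟦ j ≡ b ⟧) - (below (i - c) (j - d) - x - y * z))
                 (cong₂ below (swap i c a) (swap j d b))
                 (⟦≤⟧-shift {a} {i - c} {a + c} {i} (shift a c i))
                 (⟦≡⟧-shift {j - d} {b} {j} {b + d} (shift′ b d j)) ⟩
      (below i j - below (i - a) (j - b) - ⟦ a ≤ i ⟧ * ⟦ j ≡ b ⟧)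
        - (below (i - c) (j - d) - below (i - a - c) (j - b - d) - ⟦ a + c ≤ i ⟧ * ⟦ j ≡ b + d ⟧)
        ≡⟨ regroup (below i j) (below (i - a) (j - b)) (below (i - c) (j - d)) (below (i - a - c) (j - b - d))
                   (⟦ a ≤ i ⟧ * ⟦ j ≡ b ⟧) (⟦ a + c ≤ i ⟧ * ⟦ j ≡ b + d ⟧) ⟩
      □ below i j - ⟦ a ≤ i ⟧ * ⟦ j ≡ b ⟧ + ⟦ a + c ≤ i ⟧ * ⟦ j ≡ b + d ⟧ ∎
      where
      open ≡-Reasoning
      swap : ∀ i c a → i - c - a ≡ i - a - c
      swap = solve-∀
      shift : ∀ a c i → i - c - a ≡ i - (a + c)
      shift = solve-∀
      shift′ : ∀ b d j → b - (j - d) ≡ b + d - j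
      shift′ = solve-∀
      regroup : ∀ B₀ B₁ B₂ B₃ R R′ → (B₀ - B₁ - R) - (B₂ - B₃ - R′) ≡ B₀ - B₁ - B₂ + B₃ - R + R′
      regroup = solve-∀

    strip-coeff : ∀ I J → ⟦ + 0 ≤ J ⟧ * ⟦ J < b - + 1 ⟧ * (⟦ (J + + 1) * a < b * (I + + 1) ⟧ - ⟦ (J + + 1) * a < b * I ⟧)
      ≡ strip (I + + 1) (J + + 1) - strip I (J + + 1)
    strip-coeff I J = begin
      ⟦ + 0 ≤ J ⟧ * ⟦ J < b - + 1 ⟧ * (⟦ (J + + 1) * a < b * (I + + 1) ⟧ - ⟦ (J + + 1) * a < b * I ⟧)
        ≡⟨ cong₂ (λ x y → x * y * (⟦ (J + + 1) * a < b * (I + + 1) ⟧ - ⟦ (J + + 1) * a < b * I ⟧))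
                 (⟦≤⟧-shift {+ 0} {J} {+ 1} {J + + 1} (shift₁ J))
                 (trans (⟦<⟧-as-⟦≤⟧ J (b - + 1)) refl) ⟩
      ⟦ + 1 ≤ J + + 1 ⟧ * ⟦ J + + 1 ≤ b - + 1 ⟧ * (⟦ (J + + 1) * a < b * (I + + 1) ⟧ - ⟦ (J + + 1) * a < b * I ⟧)
        ≡⟨ cong₂ (λ x y → ⟦ + 1 ≤ J + + 1 ⟧ * ⟦ J + + 1 ≤ b - + 1 ⟧ * (x - y))
                 (⟦<⟧-shift {(J + + 1) * a} {b * (I + + 1)} {s (I + + 1) (J + + 1)} {+ 0} (shift₂ a b I J))
                 (⟦<⟧-shift {(J + + 1) * a} {b * I} {s I (J + + 1)} {+ 0} (shift₃ a b I J)) ⟩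
      ⟦ + 1 ≤ J + + 1 ⟧ * ⟦ J + + 1 ≤ b - + 1 ⟧ * (⟦ s (I + + 1) (J + + 1) < + 0 ⟧ - ⟦ s I (J + + 1) < + 0 ⟧)
        ≡⟨ distrib (⟦ + 1 ≤ J + + 1 ⟧ * ⟦ J + + 1 ≤ b - + 1 ⟧) ⟦ s (I + + 1) (J + + 1) < + 0 ⟧ ⟦ s I (J + + 1) < + 0 ⟧ ⟩
      strip (I + + 1) (J + + 1) - strip I (J + + 1) ∎
      where
      open ≡-Reasoning
      shift₁ : ∀ J → J - + 0 ≡ J + + 1 - + 1
      shift₁ = solve-∀
      shift₂ : ∀ a b I J → b * (I + + 1) - (J + + 1) * a ≡ + 0 - (a * (J + + 1) - b * (I + + 1))
      shift₂ = solve-∀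
      shift₃ : ∀ a b I J → b * I - (J + + 1) * a ≡ + 0 - (a * (J + + 1) - b * I)
      shift₃ = solve-∀
      distrib : ∀ x p q → x * (p - q) ≡ x * p - x * q
      distrib = solve-∀

  module LatticeIdentity (a b c d : ℤ)
    (a≥1 : Nonneg (a - + 1)) (b≥1 : Nonneg (b - + 1)) (c≥1 : Nonneg (c - + 1)) (d≥1 : Nonneg (d - + 1))
    (Δ≥1 : Nonneg (a * d - b * c - + 1))
    (segment-ab : ∀ i j → a * j - b * i ≡ + 0 → Nonneg (j - + 1) → Nonneg (b - j) → i ≡ a × j ≡ b)
    (segment-cd : ∀ j i → d * i - c * j ≡ + 0 → Nonneg (i - + 1) → Nonneg (c - i) → j ≡ d × i ≡ c) where

    open LineGeometry a b c d a≥1 b≥1 segment-ab public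

    -- The same constructions for the line through 0 and (c , d), obtained from
    -- the symmetry (i , j , a , b , c , d) ↦ (j , i , d , c , b , a).
    module Mirror = LineGeometry d c b a d≥1 c≥1 segment-cd

    -- Position relative to the line through 0 and (c , d): t < 0 above it.
    t : ℤ → ℤ → ℤ
    t i j = d * i - c * j

    κ : ℤ → ℤ → ℤ
    κ i j = ⟦ + 0 < s i j ⟧ * ⟦ + 0 < t i j ⟧

    apex : ℤ → ℤ → ℤ
    apex i j = ⟦ i ≡ a + c ⟧ * ⟦ j ≡ b + d ⟧

    slab : ℤ → ℤ → ℤ
    slab i j = ⟦ + 1 ≤ s i j ⟧ * ⟦ s i j ≤ Δ - + 1 ⟧ * (⟦ + 0 < t i j ⟧ - ⟦ Δ < t i j ⟧)

    private
      Δ-i : ∀ a b c d i j → (a * d - b * c) * i ≡ c * (a * j - b * i) + a * (d * i - c * j)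
      Δ-i = solve-∀
      Δ-j : ∀ a b c d i j → (a * d - b * c) * j ≡ d * (a * j - b * i) + b * (d * i - c * j)
      Δ-j = solve-∀
      zero-one : ∀ x → + 0 - x ≡ + 1 - x - + 1
      zero-one = solve-∀

    -- Inside the cone both coordinates are positive (as Δ i = c s + a t and
    -- Δ j = d s + b t), and where s ≤ 0 and t ≤ 0 both are non-positive.
    cone-positive : ∀ i j → Nonneg (s i j - + 0 - + 1) → Nonneg (t i j - + 0 - + 1) → Nonneg (i - + 1) × Nonneg (j - + 1)
    cone-positive i j s>0 t>0 =
        positive-factor {Δ} {i} Δ≥1 (cast (positive-sum {c} {a} {s i j} {t i j} c≥1 a≥1 s>0 t>0) (cong (_- + 1) (sym (Δ-i a b c d i j))))
      , positive-factor {Δ} {j} Δ≥1 (cast (positive-sum {d} {b} {s i j} {t i j} d≥1 b≥1 s>0 t>0) (cong (_- + 1) (sym (Δ-j a b c d i j))))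

    opposite-cone : ∀ i j → Nonneg (+ 0 - s i j) → Nonneg (+ 0 - t i j) → Nonneg (+ 0 - i) × Nonneg (+ 0 - j)
    opposite-cone i j s≤0 t≤0 =
        nonpositive-factor {Δ} {i} Δ≥1 (cast (nonpositive-sum {c} {a} {s i j} {t i j} c≥1 a≥1 s≤0 t≤0) (cong (λ w → + 0 - w) (sym (Δ-i a b c d i j))))
      , nonpositive-factor {Δ} {j} Δ≥1 (cast (nonpositive-sum {d} {b} {s i j} {t i j} d≥1 b≥1 s≤0 t≤0) (cong (λ w → + 0 - w) (sym (Δ-j a b c d i j))))

    private
      evaluate : ∀ {x x′ y y′ p p′ q q′ m m′ n n′ : ℤ} → x ≡ x′ → y ≡ y′ → p ≡ p′ → q ≡ q′ → m ≡ m′ → n ≡ n′ →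
        x′ * y′ ≡ p′ * q′ + m′ * y′ + n′ * x′ → x * y ≡ p * q + m * y + n * x
      evaluate refl refl refl refl refl refl e = e

    quadrant-split : ∀ i j → ⟦ + 1 ≤ i ⟧ * ⟦ + 1 ≤ j ⟧
      ≡ ⟦ + 0 < s i j ⟧ * ⟦ + 0 < t i j ⟧ + ⟦ s i j ≤ + 0 ⟧ * ⟦ + 1 ≤ j ⟧ + ⟦ t i j ≤ + 0 ⟧ * ⟦ + 1 ≤ i ⟧
    quadrant-split i j with ≤-or-> (s i j) (+ 0) | ≤-or-> (t i j) (+ 0)
    ... | inj₁ s≤0 | inj₁ t≤0 = evaluate
      (⟦≤⟧-zero {+ 1} {i} (cast (proj₁ (opposite-cone i j s≤0 t≤0)) (zero-one i)))
      (⟦≤⟧-zero {+ 1} {j} (cast (proj₂ (opposite-cone i j s≤0 t≤0)) (zero-one j)))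
      (⟦<⟧-zero {+ 0} {s i j} s≤0) (⟦<⟧-zero {+ 0} {t i j} t≤0) (⟦≤⟧-one {s i j} {+ 0} s≤0) (⟦≤⟧-one {t i j} {+ 0} t≤0) refl
    ... | inj₂ s>0 | inj₂ t>0 = evaluate
      (⟦≤⟧-one {+ 1} {i} (proj₁ (cone-positive i j s>0 t>0))) (⟦≤⟧-one {+ 1} {j} (proj₂ (cone-positive i j s>0 t>0)))
      (⟦<⟧-one {+ 0} {s i j} s>0) (⟦<⟧-one {+ 0} {t i j} t>0) (⟦≤⟧-zero {s i j} {+ 0} s>0) (⟦≤⟧-zero {t i j} {+ 0} t>0) refl
    ... | inj₁ s≤0 | inj₂ t>0 with ≤-or-> (+ 1) j
    ...   | inj₁ j≥1 = evaluate
      (⟦≤⟧-one {+ 1} {i} (below-line-positive i j s≤0 j≥1)) (⟦≤⟧-one {+ 1} {j} j≥1)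
      (⟦<⟧-zero {+ 0} {s i j} s≤0) (⟦<⟧-one {+ 0} {t i j} t>0) (⟦≤⟧-one {s i j} {+ 0} s≤0) (⟦≤⟧-zero {t i j} {+ 0} t>0) refl
    ...   | inj₂ j<1 = evaluate {x′ = ⟦ + 1 ≤ i ⟧}
      refl (⟦≤⟧-zero {+ 1} {j} j<1)
      (⟦<⟧-zero {+ 0} {s i j} s≤0) (⟦<⟧-one {+ 0} {t i j} t>0) (⟦≤⟧-one {s i j} {+ 0} s≤0) (⟦≤⟧-zero {t i j} {+ 0} t>0)
      (ℤP.*-zeroʳ ⟦ + 1 ≤ i ⟧)
    quadrant-split i j | inj₂ s>0 | inj₁ t≤0 with ≤-or-> (+ 1) i
    ...   | inj₁ i≥1 = evaluate
      (⟦≤⟧-one {+ 1} {i} i≥1) (⟦≤⟧-one {+ 1} {j} (Mirror.below-line-positive j i t≤0 i≥1))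
      (⟦<⟧-one {+ 0} {s i j} s>0) (⟦<⟧-zero {+ 0} {t i j} t≤0) (⟦≤⟧-zero {s i j} {+ 0} s>0) (⟦≤⟧-one {t i j} {+ 0} t≤0) refl
    ...   | inj₂ i<1 = evaluate {y′ = ⟦ + 1 ≤ j ⟧}
      (⟦≤⟧-zero {+ 1} {i} i<1) refl
      (⟦<⟧-one {+ 0} {s i j} s>0) (⟦<⟧-zero {+ 0} {t i j} t≤0) (⟦≤⟧-zero {s i j} {+ 0} s>0) (⟦≤⟧-one {t i j} {+ 0} t≤0) refl

    □-cong : ∀ {F G : ℤ → ℤ → ℤ} → (∀ i j → F i j ≡ G i j) → ∀ i j → □ F i j ≡ □ G i j
    □-cong F≡G i j = cong₂ _+_ (cong₂ _-_ (cong₂ _-_ (F≡G i j) (F≡G (i - a) (j - b))) (F≡G (i - c) (j - d)))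
                               (F≡G (i - a - c) (j - b - d))

    □-+ : ∀ F G i j → □ (λ i j → F i j + G i j) i j ≡ □ F i j + □ G i j
    □-+ F G i j = linear (F i j) (F (i - a) (j - b)) (F (i - c) (j - d)) (F (i - a - c) (j - b - d))
                         (G i j) (G (i - a) (j - b)) (G (i - c) (j - d)) (G (i - a - c) (j - b - d))
      where linear : ∀ f₁ f₂ f₃ f₄ g₁ g₂ g₃ g₄ →
                       f₁ + g₁ - (f₂ + g₂) - (f₃ + g₃) + (f₄ + g₄) ≡ (f₁ - f₂ - f₃ + f₄) + (g₁ - g₂ - g₃ + g₄)
            linear = solve-∀

    □-mirror : ∀ F i j → □ (λ i j → F j i) i j ≡ Mirror.□ F j i
    □-mirror F i j =
      trans (cong (λ x → F j i - F (j - b) (i - a) - F (j - d) (i - c) + x) (cong₂ F (swap j b d) (swap i a c)))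
            (exchange (F j i) (F (j - b) (i - a)) (F (j - d) (i - c)) (F (j - d - b) (i - c - a)))
      where swap : ∀ j b d → j - b - d ≡ j - d - b
            swap = solve-∀
            exchange : ∀ x y z w → x - y - z + w ≡ x - z - y + w
            exchange = solve-∀

    quadrant-□ : ∀ i j → □ (quadrant (+ 1 , + 1)) i j ≡ □ κ i j + □ below i j + Mirror.□ Mirror.below j i
    quadrant-□ i j =
      trans (□-cong quadrant-split i j)
      (trans (□-+ (λ i j → κ i j + below i j) (λ i j → Mirror.below j i) i j)
             (cong₂ _+_ (□-+ κ below i j) (□-mirror Mirror.below i j)))

    private
      s-ab : ∀ a b i j → a * (j - b) - b * (i - a) - + 0 ≡ a * j - b * i - + 0
      s-ab = solve-∀
      s-cd : ∀ a b c d i j → a * (j - d) - b * (i - c) - + 0 ≡ a * j - b * i - (a * d - b * c)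
      s-cd = solve-∀
      s-abcd : ∀ a b c d i j → a * (j - b - d) - b * (i - a - c) - + 0 ≡ a * j - b * i - (a * d - b * c)
      s-abcd = solve-∀
      t-ab : ∀ a b c d i j → d * (i - a) - c * (j - b) - + 0 ≡ d * i - c * j - (a * d - b * c)
      t-ab = solve-∀
      t-cd : ∀ c d i j → d * (i - c) - c * (j - d) - + 0 ≡ d * i - c * j - + 0
      t-cd = solve-∀
      t-abcd : ∀ a b c d i j → d * (i - a - c) - c * (j - b - d) - + 0 ≡ d * i - c * j - (a * d - b * c)
      t-abcd = solve-∀
      expand : ∀ σ₀ σ₁ τ₀ τ₁ → σ₀ * τ₀ - σ₀ * τ₁ - σ₁ * τ₀ + σ₁ * τ₁ ≡ (σ₀ - σ₁) * (τ₀ - τ₁)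
      expand = solve-∀

    κ-□ : ∀ i j → □ κ i j ≡ (⟦ + 0 < s i j ⟧ - ⟦ Δ < s i j ⟧) * (⟦ + 0 < t i j ⟧ - ⟦ Δ < t i j ⟧)
    κ-□ i j = trans (cong₃ (λ x y z → κ i j - x - y + z)
                           (cong₂ _*_ (⟦<⟧-shift {+ 0} {s (i - a) (j - b)} {+ 0} {s i j} (s-ab a b i j))
                                      (⟦<⟧-shift {+ 0} {t (i - a) (j - b)} {Δ} {t i j} (t-ab a b c d i j)))
                           (cong₂ _*_ (⟦<⟧-shift {+ 0} {s (i - c) (j - d)} {Δ} {s i j} (s-cd a b c d i j))
                                      (⟦<⟧-shift {+ 0} {t (i - c) (j - d)} {+ 0} {t i j} (t-cd c d i j)))
                           (cong₂ _*_ (⟦<⟧-shift {+ 0} {s (i - a - c) (j - b - d)} {Δ} {s i j} (s-abcd a b c d i j))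
                                      (⟦<⟧-shift {+ 0} {t (i - a - c) (j - b - d)} {Δ} {t i j} (t-abcd a b c d i j))))
                    (expand ⟦ + 0 < s i j ⟧ ⟦ Δ < s i j ⟧ ⟦ + 0 < t i j ⟧ ⟦ Δ < t i j ⟧)

    -- On the line s = 0 the window 0 < t ≤ Δ is the window 1 ≤ j ≤ b (as Δ j = b t there).
    on-line-window : ∀ i j → ⟦ s i j ≡ + 0 ⟧ * (⟦ + 0 < t i j ⟧ - ⟦ Δ < t i j ⟧)
                            ≡ ⟦ s i j ≡ + 0 ⟧ * (⟦ + 1 ≤ j ⟧ - ⟦ b + + 1 ≤ j ⟧)
    on-line-window i j with s i j ≟ + 0
    ... | no _ = refl
    ... | yes on-line = cong (+ 1 *_) (cong₂ _-_ lower upper)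
      where
      Δj≡bt : Δ * j ≡ d * + 0 + b * t i j
      Δj≡bt = trans (Δ-j a b c d i j) (cong (λ x → d * x + b * t i j) on-line)
      line₀ : ∀ b d t Δ → b * t - b * + 0 ≡ d * + 0 + b * t - Δ * + 0
      line₀ = solve-∀
      lineΔ : ∀ b d t Δ → b * t - b * Δ ≡ d * + 0 + b * t - Δ * b
      lineΔ = solve-∀
      lower : ⟦ + 0 < t i j ⟧ ≡ ⟦ + 1 ≤ j ⟧
      lower = begin
        ⟦ + 0 < t i j ⟧                ≡⟨ sym (⟦<⟧-scale b b≥1 (+ 0) (t i j)) ⟩
        ⟦ b * + 0 < b * t i j ⟧        ≡⟨ ⟦<⟧-shift {b * + 0} {b * t i j} {Δ * + 0} {Δ * j} (trans (line₀ b d (t i j) Δ) (cong (_- Δ * + 0) (sym Δj≡bt))) ⟩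
        ⟦ Δ * + 0 < Δ * j ⟧            ≡⟨ ⟦<⟧-scale Δ Δ≥1 (+ 0) j ⟩
        ⟦ + 0 < j ⟧                    ≡⟨ ⟦<⟧-as-⟦≤⟧ (+ 0) j ⟩
        ⟦ + 1 ≤ j ⟧                    ∎
        where open ≡-Reasoning
      upper : ⟦ Δ < t i j ⟧ ≡ ⟦ b + + 1 ≤ j ⟧
      upper = begin
        ⟦ Δ < t i j ⟧                  ≡⟨ sym (⟦<⟧-scale b b≥1 Δ (t i j)) ⟩
        ⟦ b * Δ < b * t i j ⟧          ≡⟨ ⟦<⟧-shift {b * Δ} {b * t i j} {Δ * b} {Δ * j} (trans (lineΔ b d (t i j) Δ) (cong (_- Δ * b) (sym Δj≡bt))) ⟩
        ⟦ Δ * b < Δ * j ⟧              ≡⟨ ⟦<⟧-scale Δ Δ≥1 b j ⟩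
        ⟦ b < j ⟧                      ≡⟨ ⟦<⟧-as-⟦≤⟧ b j ⟩
        ⟦ b + + 1 ≤ j ⟧                ∎
        where open ≡-Reasoning

    apex-count : ∀ i j → ⟦ s i j ≡ Δ ⟧ * (⟦ + 0 < t i j ⟧ - ⟦ Δ < t i j ⟧) ≡ apex i j
    apex-count i j = begin
      ⟦ s i j ≡ Δ ⟧ * (⟦ + 0 < t i j ⟧ - ⟦ Δ < t i j ⟧)
        ≡⟨ cong₂ (λ x y → x * (⟦ + 0 < y ⟧ - ⟦ Δ < y ⟧))
                 (⟦≡⟧-shift {s i j} {Δ} {s i′ j′} {+ 0} (trans (on-translate a b c d i j) (cong (λ w → + 0 - w) (sym (s-shift a b c d i j)))))
                 (sym (t-shift c d i j)) ⟩
      ⟦ s i′ j′ ≡ + 0 ⟧ * (⟦ + 0 < t i′ j′ ⟧ - ⟦ Δ < t i′ j′ ⟧)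
        ≡⟨ on-line-window i′ j′ ⟩
      ⟦ s i′ j′ ≡ + 0 ⟧ * (⟦ + 1 ≤ j′ ⟧ - ⟦ b + + 1 ≤ j′ ⟧)
        ≡⟨ segment-count i′ j′ ⟩
      ⟦ i′ ≡ a ⟧ * ⟦ j′ ≡ b ⟧
        ≡⟨ cong₂ _*_ (⟦≡⟧-shift {i′} {a} {i} {a + c} (translate a c i)) (⟦≡⟧-shift {j′} {b} {j} {b + d} (translate b d j)) ⟩
      apex i j ∎
      where
      open ≡-Reasoning
      i′ = i - c
      j′ = j - d
      s-shift : ∀ a b c d i j → a * (j - d) - b * (i - c) ≡ a * j - b * i - (a * d - b * c)
      s-shift = solve-∀
      on-translate : ∀ a b c d i j → a * d - b * c - (a * j - b * i) ≡ + 0 - (a * j - b * i - (a * d - b * c))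
      on-translate = solve-∀
      t-shift : ∀ c d i j → d * (i - c) - c * (j - d) ≡ d * i - c * j
      t-shift = solve-∀
      translate : ∀ a c i → a - (i - c) ≡ a + c - i
      translate = solve-∀

    slab-□ : ∀ i j → slab i j ≡ □ κ i j - apex i j
    slab-□ i j = begin
      ⟦ + 1 ≤ s i j ⟧ * ⟦ s i j ≤ Δ - + 1 ⟧ * T
        ≡⟨ cong (_* T) (window (+ 1) Δ (s i j) Δ≥1) ⟩
      (⟦ + 1 ≤ s i j ⟧ - ⟦ Δ + + 1 ≤ s i j ⟧ - ⟦ s i j ≡ Δ ⟧) * T
        ≡⟨ cong₂ (λ x y → (x - y - ⟦ s i j ≡ Δ ⟧) * T) (sym (⟦<⟧-as-⟦≤⟧ (+ 0) (s i j))) (sym (⟦<⟧-as-⟦≤⟧ Δ (s i j))) ⟩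
      (⟦ + 0 < s i j ⟧ - ⟦ Δ < s i j ⟧ - ⟦ s i j ≡ Δ ⟧) * T
        ≡⟨ distribute (⟦ + 0 < s i j ⟧ - ⟦ Δ < s i j ⟧) ⟦ s i j ≡ Δ ⟧ T ⟩
      (⟦ + 0 < s i j ⟧ - ⟦ Δ < s i j ⟧) * T - ⟦ s i j ≡ Δ ⟧ * T
        ≡⟨ cong₂ _-_ (sym (κ-□ i j)) (apex-count i j) ⟩
      □ κ i j - apex i j ∎
      where
      open ≡-Reasoning
      T = ⟦ + 0 < t i j ⟧ - ⟦ Δ < t i j ⟧
      distribute : ∀ x y z → (x - y) * z ≡ x * z - y * z
      distribute = solve-∀

    corner : ∀ i j → ⟦ a + c ≤ i ⟧ * ⟦ j ≡ b + d ⟧ + ⟦ d + b ≤ j ⟧ * ⟦ i ≡ c + a ⟧ - apex i j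
                     ≡ quadrant (a + c , b + d) i j - quadrant (a + c + + 1 , b + d + + 1) i j
    corner i j = trans (cong (λ x → ⟦ a + c ≤ i ⟧ * ⟦ j ≡ b + d ⟧ + x - apex i j)
                             (trans (cong₂ (λ x y → ⟦ x ≤ j ⟧ * ⟦ i ≡ y ⟧) (ℤP.+-comm d b) (ℤP.+-comm c a))
                                    (ℤP.*-comm ⟦ b + d ≤ j ⟧ ⟦ i ≡ a + c ⟧)))
                       (sym (hook (a + c) (b + d) i j))

    -- The function whose mixed difference is the coefficient of the left-hand side.
    lhs-cumulative : ℤ → ℤ → ℤ
    lhs-cumulative i j = slab i j + (strip i j - strip (i - c) (j - d)) + (Mirror.strip j i - Mirror.strip (j - b) (i - a))

    pointwise : ∀ i j → lhs-cumulative i j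
      ≡ □ (quadrant (+ 1 , + 1)) i j - ⟦ a ≤ i ⟧ * ⟦ j ≡ b ⟧ - ⟦ d ≤ j ⟧ * ⟦ i ≡ c ⟧
        + (quadrant (a + c , b + d) i j - quadrant (a + c + + 1 , b + d + + 1) i j)
    pointwise i j = begin
      lhs-cumulative i j
        ≡⟨ cong₃ (λ x y z → x + y + z) (slab-□ i j) (strip-step i j) (Mirror.strip-step j i) ⟩
      (□ κ i j - apex i j) + (□ below i j - ρ + ρ′) + (Mirror.□ Mirror.below j i - σ + σ′)
        ≡⟨ regroup (□ κ i j) (□ below i j) (Mirror.□ Mirror.below j i) (apex i j) ρ ρ′ σ σ′ ⟩
      (□ κ i j + □ below i j + Mirror.□ Mirror.below j i) - ρ - σ + (ρ′ + σ′ - apex i j)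
        ≡⟨ cong₂ (λ x y → x - ρ - σ + y) (sym (quadrant-□ i j)) (corner i j) ⟩
      □ (quadrant (+ 1 , + 1)) i j - ρ - σ + (quadrant (a + c , b + d) i j - quadrant (a + c + + 1 , b + d + + 1) i j) ∎
      where
      open ≡-Reasoning
      ρ = ⟦ a ≤ i ⟧ * ⟦ j ≡ b ⟧
      ρ′ = ⟦ a + c ≤ i ⟧ * ⟦ j ≡ b + d ⟧
      σ = ⟦ d ≤ j ⟧ * ⟦ i ≡ c ⟧
      σ′ = ⟦ d + b ≤ j ⟧ * ⟦ i ≡ c + a ⟧
      regroup : ∀ k n m e r r′ q q′ → (k - e) + (n - r + r′) + (m - q + q′) ≡ (k + n + m) - r - q + (r′ + q′ - e)
      regroup = solve-∀

  module Reciprocity (a b c d : ℕ) (0<a : 0 ℕ.< a) (0<b : 0 ℕ.< b) (0<c : 0 ℕ.< c) (0<d : 0 ℕ.< d)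
    (bc<ad : b ℕ.* c ℕ.< a ℕ.* d) (coprime-ab : gcd a b ≡ 1) (coprime-cd : gcd c d ≡ 1)
    (x y : ℤ) (bezout : + a * x + + b * y ≡ + 1) where

    import Data.Nat.Properties as ℕP

    A B C D : ℤ
    A = + a
    B = + b
    C = + c
    D = + d

    Δn : ℕ
    Δn = a ℕ.* d ℕ.∸ b ℕ.* c

    instance
      b-nonzero : ℕ.NonZero b
      b-nonzero = ℕ.>-nonZero 0<b
      c-nonzero : ℕ.NonZero c
      c-nonzero = ℕ.>-nonZero 0<c
      Δ-nonzero : ℕ.NonZero Δn
      Δ-nonzero = ℕ.>-nonZero (ℕP.m<n⇒0<n∸m bc<ad)

    positive : ∀ n → 0 ℕ.< n → Nonneg (+ n - + 1)
    positive n 0<n = ≤⇒nonneg (ℤ.+≤+ 0<n)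

    Δn≡Δ : + Δn ≡ A * D - B * C
    Δn≡Δ = trans (sym (ℤP.⊖-≥ (ℕP.<⇒≤ bc<ad)))
           (trans (sym (ℤP.m-n≡m⊖n (a ℕ.* d) (b ℕ.* c))) (cong₂ _-_ (ℤP.pos-* a d) (ℤP.pos-* b c)))

    open LatticeIdentity A B C D (positive a 0<a) (positive b 0<b) (positive c 0<c) (positive d 0<d)
      (cast (<⇒nonneg (ℤ.+<+ bc<ad)) (cong₂ (λ p q → p - q - + 1) (ℤP.pos-* a d) (ℤP.pos-* b c)))
      (λ i j on-line j≥1 j≤b → primitive-segment a b 0<a 0<b coprime-ab i j on-line (nonneg⇒≤ j≥1) (nonneg⇒≤ j≤b))
      (λ j i on-line i≥1 i≤c → primitive-segment d c 0<d 0<c (trans (gcd-comm d c) coprime-cd) j i on-line (nonneg⇒≤ i≥1) (nonneg⇒≤ i≤c))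

    u v one : LPoly
    u = mono U
    v = mono V
    one = const (+ 1)

    α : ℤ
    α = C * x + D * y

    DC₁ DC₂ DC₃ : LPoly
    DC₁ = DC V U D c
    DC₂ = DC U V A b
    DC₃ = DC (A , B) (- y , x) α Δn

    private
      unit₁ : ∀ F k → F * + 1 + k * + 0 ≡ F
      unit₁ = solve-∀
      unit₂ : ∀ F k → F * + 0 + k * + 1 ≡ k
      unit₂ = solve-∀

    DC₁-coeff : ∀ I J → coeff DC₁ (I , J) ≡ Mirror.strip (J + + 1) (I + + 1) - Mirror.strip J (I + + 1)
    DC₁-coeff I J =
      trans (DC-coeff (+ 0) (+ 1) (+ 1) (+ 0) D c I J J I (unit₂ J I) (unit₁ J I)
                      (λ F k e₁ e₂ → trans (sym (unit₂ F k)) e₁ , trans (sym (unit₁ F k)) e₂))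
            (Mirror.strip-coeff J I)

    DC₂-coeff : ∀ I J → coeff DC₂ (I , J) ≡ strip (I + + 1) (J + + 1) - strip I (J + + 1)
    DC₂-coeff I J =
      trans (DC-coeff (+ 1) (+ 0) (+ 0) (+ 1) A b I J I J (unit₁ I J) (unit₂ I J)
                      (λ F k e₁ e₂ → trans (sym (unit₂ F k)) e₂ , trans (sym (unit₁ F k)) e₁))
            (strip-coeff I J)

    private
      coordinate-I : ∀ A B x y I J → (x * I + y * J) * A + (A * J - B * I) * - y ≡ I * (A * x + B * y)
      coordinate-I = solve-∀
      coordinate-J : ∀ A B x y I J → (x * I + y * J) * B + (A * J - B * I) * x ≡ J * (A * x + B * y)
      coordinate-J = solve-∀
      coordinate-k : ∀ A B x y F k → A * (F * B + k * x) - B * (F * A + k * - y) ≡ k * (A * x + B * y)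
      coordinate-k = solve-∀
      coordinate-F : ∀ A B x y F k → x * (F * A + k * - y) + y * (F * B + k * x) ≡ F * (A * x + B * y)
      coordinate-F = solve-∀
      s-translate : ∀ A B x y I J → A * J - B * I - + 0 ≡ A * (J + (B + x)) - B * (I + (A - y)) - + 1 + (+ 1 - (A * x + B * y))
      s-translate = solve-∀
      s-window : ∀ A B x y I J δ → δ - + 1 - (A * J - B * I + + 1)
                 ≡ δ - + 1 - (A * (J + (B + x)) - B * (I + (A - y))) + (A * x + B * y - + 1)
      s-window = solve-∀
      t-lower : ∀ A B C D x y I J → (A * D - B * C) * (x * I + y * J + + 1) - (A * J - B * I + + 1) * (C * x + D * y)
                ≡ D * (I + (A - y)) - C * (J + (B + x)) - + 0 + (C * J - D * I) * (+ 1 - (A * x + B * y))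
      t-lower = solve-∀
      t-upper : ∀ A B C D x y I J → (A * D - B * C) * (x * I + y * J) - (A * J - B * I + + 1) * (C * x + D * y)
                ≡ D * (I + (A - y)) - C * (J + (B + x)) - (A * D - B * C) + (C * J - D * I) * (+ 1 - (A * x + B * y))
      t-upper = solve-∀
      vanish : ∀ z w → z + w * (+ 1 - + 1) ≡ z
      vanish = solve-∀

    DC₃-coeff : ∀ I J → coeff DC₃ (I , J) ≡ slab (I + (A - y)) (J + (B + x))
    DC₃-coeff I J = trans
      (DC-coeff A B (- y) x α Δn I J p q
        (trans (coordinate-I A B x y I J) (by-bezout I)) (trans (coordinate-J A B x y I J) (by-bezout J))
        (λ F k e₁ e₂ → sym (trans (cong₂ (λ i j → A * j - B * i) (sym e₁) (sym e₂)) (trans (coordinate-k A B x y F k) (by-bezout k)))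
                     , sym (trans (cong₂ (λ i j → x * i + y * j) (sym e₁) (sym e₂)) (trans (coordinate-F A B x y F k) (by-bezout F)))))
      (cong₃ (λ X Y Z → X * Y * Z) lower-s upper-s (cong₂ _-_ lower-t upper-t))
      where
      p = x * I + y * J
      q = A * J - B * I
      s′ = s (I + (A - y)) (J + (B + x))
      t′ = t (I + (A - y)) (J + (B + x))
      by-bezout : ∀ z → z * (A * x + B * y) ≡ z
      by-bezout z = trans (cong (z *_) bezout) (ℤP.*-identityʳ z)
      bezout-vanishes : ∀ z w → z + w * (+ 1 - (A * x + B * y)) ≡ z
      bezout-vanishes z w = trans (cong (λ e → z + w * (+ 1 - e)) bezout) (vanish z w)
      lower-s : ⟦ + 0 ≤ q ⟧ ≡ ⟦ + 1 ≤ s′ ⟧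
      lower-s = ⟦≤⟧-shift {+ 0} {q} {+ 1} {s′}
        (trans (s-translate A B x y I J) (trans (cong (λ e → s′ - + 1 + (+ 1 - e)) bezout) (vanish-one (s′ - + 1))))
        where vanish-one : ∀ z → z + (+ 1 - + 1) ≡ z
              vanish-one = solve-∀
      upper-s : ⟦ q < + Δn - + 1 ⟧ ≡ ⟦ s′ ≤ Δ - + 1 ⟧
      upper-s = trans (⟦<⟧-as-⟦≤⟧ q (+ Δn - + 1)) (⟦≤⟧-shift {q + + 1} {+ Δn - + 1} {s′} {Δ - + 1}
        (trans (cong (λ δ → δ - + 1 - (q + + 1)) Δn≡Δ)
               (trans (s-window A B x y I J Δ) (trans (cong (λ e → Δ - + 1 - s′ + (e - + 1)) bezout) (vanish-zero (Δ - + 1 - s′))))))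
        where vanish-zero : ∀ z → z + (+ 1 - + 1) ≡ z
              vanish-zero = solve-∀
      lower-t : ⟦ (q + + 1) * α < + Δn * (p + + 1) ⟧ ≡ ⟦ + 0 < t′ ⟧
      lower-t = ⟦<⟧-shift {(q + + 1) * α} {+ Δn * (p + + 1)} {+ 0} {t′}
        (trans (cong (λ δ → δ * (p + + 1) - (q + + 1) * α) Δn≡Δ)
               (trans (t-lower A B C D x y I J) (bezout-vanishes (t′ - + 0) (C * J - D * I))))
      upper-t : ⟦ (q + + 1) * α < + Δn * p ⟧ ≡ ⟦ Δ < t′ ⟧
      upper-t = ⟦<⟧-shift {(q + + 1) * α} {+ Δn * p} {Δ} {t′}
        (trans (cong (λ δ → δ * p - (q + + 1) * α) Δn≡Δ)
               (trans (t-upper A B C D x y I J) (bezout-vanishes (t′ - Δ) (C * J - D * I))))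

    private
      expand₄ : ∀ x₁ x₂ x₃ x₄ → + 1 * x₁ + (-[1+ 0 ] * x₂ + (-[1+ 0 ] * x₃ + (+ 1 * x₄ + + 0))) ≡ x₁ - x₂ - x₃ + x₄
      expand₄ = solve-∀
      regroup₈ : ∀ w₁ w₂ w₃ w₄ w₅ w₆ w₇ w₈ →
        (w₁ - w₂) - (w₃ - w₄) - (w₅ - w₆) + (w₇ - w₈) ≡ (w₇ - w₅) - (w₃ - w₁) - (w₈ - w₆) + (w₄ - w₂)
      regroup₈ = solve-∀
      regroup₈′ : ∀ w₁ w₂ w₃ w₄ w₅ w₆ w₇ w₈ →
        (w₁ - w₂) - (w₃ - w₄) - (w₅ - w₆) + (w₇ - w₈) ≡ (w₇ - w₅) - (w₈ - w₆) - (w₃ - w₁) + (w₄ - w₂)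
      regroup₈′ = solve-∀
      step₁ : ∀ k p → k - (+ 2 + p) + + 1 ≡ k - + 1 - p
      step₁ = solve-∀
      step₂ : ∀ l q → l - (+ 1 + q) + + 1 ≡ l - q
      step₂ = solve-∀
      step₃ : ∀ l q → l - (+ 1 + q) ≡ l - + 1 - q
      step₃ = solve-∀
      step₄ : ∀ k → k - + 2 + + 1 ≡ k - + 1
      step₄ = solve-∀
      step₅ : ∀ k → k - + 1 + + 1 ≡ k
      step₅ = solve-∀

    term₁ : LPoly
    term₁ = u *L v *L (u -L one) *L (mono (A , B) -L one) *L DC₁

    term₁-coeff : ∀ k l → coeff term₁ (k , l) ≡ ∇ (λ i j → Mirror.strip j i - Mirror.strip (j - B) (i - A)) k l
    term₁-coeff k l =
      trans (coeff-* (u *L v *L (u -L one) *L (mono (A , B) -L one)) DC₁ (k , l))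
      (trans (expand₄ (coeff DC₁ (k - (+ 2 + A) , l - (+ 1 + B))) (coeff DC₁ (k - + 2 , l - + 1))
                      (coeff DC₁ (k - (+ 1 + A) , l - (+ 1 + B))) (coeff DC₁ (k - + 1 , l - + 1)))
      (trans (cong₄ (λ p q r s → p - q - r + s)
                    (column (step₁ k A) (step₂ l B) (step₃ l B)) (column (step₄ k) (step₅ l) refl)
                    (column (step₂ k A) (step₂ l B) (step₃ l B)) (column (step₅ k) (step₅ l) refl))
             (regroup₈ (W (k - + 1 - A) (l - B)) (W (k - + 1 - A) (l - + 1 - B)) (W (k - + 1) l) (W (k - + 1) (l - + 1))
                       (W (k - A) (l - B)) (W (k - A) (l - + 1 - B)) (W k l) (W k (l - + 1)))))
      where
      W : ℤ → ℤ → ℤ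
      W i j = Mirror.strip j i
      column : ∀ {I J i j j′} → I + + 1 ≡ i → J + + 1 ≡ j → J ≡ j′ → coeff DC₁ (I , J) ≡ W i j - W i j′
      column {I} {J} refl refl refl = DC₁-coeff I J

    term₂ : LPoly
    term₂ = u *L v *L (v -L one) *L (mono (C , D) -L one) *L DC₂

    term₂-coeff : ∀ k l → coeff term₂ (k , l) ≡ ∇ (λ i j → strip i j - strip (i - C) (j - D)) k l
    term₂-coeff k l =
      trans (coeff-* (u *L v *L (v -L one) *L (mono (C , D) -L one)) DC₂ (k , l))
      (trans (expand₄ (coeff DC₂ (k - (+ 1 + C) , l - (+ 2 + D))) (coeff DC₂ (k - + 1 , l - + 2))
                      (coeff DC₂ (k - (+ 1 + C) , l - (+ 1 + D))) (coeff DC₂ (k - + 1 , l - + 1)))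
      (trans (cong₄ (λ p q r s → p - q - r + s)
                    (row (step₂ k C) (step₃ k C) (step₁ l D)) (row (step₅ k) refl (step₄ l))
                    (row (step₂ k C) (step₃ k C) (step₂ l D)) (row (step₅ k) refl (step₅ l)))
             (regroup₈′ (strip (k - C) (l - + 1 - D)) (strip (k - + 1 - C) (l - + 1 - D)) (strip k (l - + 1)) (strip (k - + 1) (l - + 1))
                        (strip (k - C) (l - D)) (strip (k - + 1 - C) (l - D)) (strip k l) (strip (k - + 1) l))))
      where
      row : ∀ {I J i i′ j} → I + + 1 ≡ i → I ≡ i′ → J + + 1 ≡ j → coeff DC₂ (I , J) ≡ strip i j - strip i′ j
      row {I} {J} refl refl refl = DC₂-coeff I J

    term₃ : LPoly
    term₃ = mono (A - y , B + x) *L (u -L one) *L (v -L one) *L DC₃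

    term₃-coeff : ∀ k l → coeff term₃ (k , l) ≡ ∇ slab k l
    term₃-coeff k l =
      trans (coeff-* (mono (A - y , B + x) *L (u -L one) *L (v -L one)) DC₃ (k , l))
      (trans (expand₄ (coeff DC₃ (k - (M₁ + + 1 + + 0) , l - (M₂ + + 0 + + 1))) (coeff DC₃ (k - (M₁ + + 1 + + 0) , l - (M₂ + + 0 + + 0)))
                      (coeff DC₃ (k - (M₁ + + 0 + + 0) , l - (M₂ + + 0 + + 1))) (coeff DC₃ (k - (M₁ + + 0 + + 0) , l - (M₂ + + 0 + + 0))))
      (trans (cong₄ (λ p q r s → p - q - r + s)
                    (shifted (back₁ k M₁) (back₂ l M₂)) (shifted (back₁ k M₁) (back₀ l M₂))
                    (shifted (back₀ k M₁) (back₂ l M₂)) (shifted (back₀ k M₁) (back₀ l M₂)))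
             (reverse (slab (k - + 1) (l - + 1)) (slab (k - + 1) l) (slab k (l - + 1)) (slab k l))))
      where
      M₁ = A - y
      M₂ = B + x
      shifted : ∀ {I J i j} → I + M₁ ≡ i → J + M₂ ≡ j → coeff DC₃ (I , J) ≡ slab i j
      shifted {I} {J} refl refl = DC₃-coeff I J
      back₁ : ∀ k m → k - (m + + 1 + + 0) + m ≡ k - + 1
      back₁ = solve-∀
      back₂ : ∀ l m → l - (m + + 0 + + 1) + m ≡ l - + 1
      back₂ = solve-∀
      back₀ : ∀ k m → k - (m + + 0 + + 0) + m ≡ k
      back₀ = solve-∀
      reverse : ∀ w₁ w₂ w₃ w₄ → w₁ - w₂ - w₃ + w₄ ≡ w₄ - w₂ - w₃ + w₁
      reverse = solve-∀

    lhs rhs : LPoly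
    lhs = term₁ +L term₂ +L term₃
    rhs = mono (A + C , B + D) -L mono (A , B) *L (u *L v -L v +L one) -L mono (C , D) *L (u *L v -L u +L one) +L u *L v

    lhs-coeff : ∀ k l → coeff lhs (k , l) ≡ ∇ lhs-cumulative k l
    lhs-coeff k l = begin
      coeff (term₁ +L term₂ +L term₃) (k , l)
        ≡⟨ trans (coeff-+ (term₁ +L term₂) term₃ (k , l)) (cong (_+ coeff term₃ (k , l)) (coeff-+ term₁ term₂ (k , l))) ⟩
      coeff term₁ (k , l) + coeff term₂ (k , l) + coeff term₃ (k , l)
        ≡⟨ cong₂ _+_ (cong₂ _+_ (term₁-coeff k l) (term₂-coeff k l)) (term₃-coeff k l) ⟩
      ∇ F₁ k l + ∇ F₂ k l + ∇ slab k l
        ≡⟨ reverse (∇ F₁ k l) (∇ F₂ k l) (∇ slab k l) ⟩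
      ∇ slab k l + ∇ F₂ k l + ∇ F₁ k l
        ≡⟨ sym (trans (∇-+ (λ i j → slab i j + F₂ i j) F₁ k l) (cong (_+ ∇ F₁ k l) (∇-+ slab F₂ k l))) ⟩
      ∇ lhs-cumulative k l ∎
      where
      open ≡-Reasoning
      F₁ F₂ : ℤ → ℤ → ℤ
      F₁ i j = Mirror.strip j i - Mirror.strip (j - B) (i - A)
      F₂ i j = strip i j - strip (i - C) (j - D)
      reverse : ∀ x y z → x + y + z ≡ z + y + x
      reverse = solve-∀

    private
      signed₈ : ∀ q₁ q₂ q₃ q₄ q₅ q₆ q₇ q₈ →
        + 1 * q₁ + (-[1+ 0 ] * q₂ + (+ 1 * q₃ + (-[1+ 0 ] * q₄ + (-[1+ 0 ] * q₅ + (+ 1 * q₆ + (-[1+ 0 ] * q₇ + (+ 1 * q₈ + + 0)))))))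
        ≡ q₁ - q₂ + q₃ - q₄ - q₅ + q₆ - q₇ + q₈
      signed₈ = solve-∀
      regroup₉ : ∀ q₁ q₂ q₃ q₄ q₅ q₆ q₇ q₈ r →
        q₁ - q₂ + q₃ - q₄ - q₅ + q₆ - q₇ + q₈ ≡ (q₈ - q₂ - q₅ + r) - (q₄ - q₃) - (q₇ - q₆) + (q₁ - r)
      regroup₉ = solve-∀
      assoc : ∀ i a c → i - a - c ≡ i - (a + c)
      assoc = solve-∀

    cumulative-rhs : ∀ i j → cumulative rhs i j
      ≡ □ (quadrant (+ 1 , + 1)) i j - ⟦ A ≤ i ⟧ * ⟦ j ≡ B ⟧ - ⟦ D ≤ j ⟧ * ⟦ i ≡ C ⟧
        + (quadrant (A + C , B + D) i j - quadrant (A + C + + 1 , B + D + + 1) i j)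
    cumulative-rhs i j = begin
      cumulative rhs i j
        ≡⟨ signed₈ (Q (A + C , B + D)) (Q (A + + 1 , B + + 1)) (Q (A + + 0 , B + + 1)) (Q (A + + 0 , B + + 0))
                   (Q (C + + 1 , D + + 1)) (Q (C + + 1 , D + + 0)) (Q (C + + 0 , D + + 0)) (Q (+ 1 , + 1)) ⟩
      Q (A + C , B + D) - Q (A + + 1 , B + + 1) + Q (A + + 0 , B + + 1) - Q (A + + 0 , B + + 0)
        - Q (C + + 1 , D + + 1) + Q (C + + 1 , D + + 0) - Q (C + + 0 , D + + 0) + Q (+ 1 , + 1)
        ≡⟨ cong₄ (λ p q r s → Q (A + C , B + D) - Q (A + + 1 , B + + 1) + p - q - Q (C + + 1 , D + + 1) + r - s + Q (+ 1 , + 1))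
                 (cong (λ e → Q (e , B + + 1)) (ℤP.+-identityʳ A)) (cong₂ (λ e f → Q (e , f)) (ℤP.+-identityʳ A) (ℤP.+-identityʳ B))
                 (cong (λ f → Q (C + + 1 , f)) (ℤP.+-identityʳ D)) (cong₂ (λ e f → Q (e , f)) (ℤP.+-identityʳ C) (ℤP.+-identityʳ D)) ⟩
      Q (A + C , B + D) - Q (A + + 1 , B + + 1) + Q (A , B + + 1) - Q (A , B)
        - Q (C + + 1 , D + + 1) + Q (C + + 1 , D) - Q (C , D) + Q (+ 1 , + 1)
        ≡⟨ regroup₉ (Q (A + C , B + D)) (Q (A + + 1 , B + + 1)) (Q (A , B + + 1)) (Q (A , B))
                    (Q (C + + 1 , D + + 1)) (Q (C + + 1 , D)) (Q (C , D)) (Q (+ 1 , + 1)) (Q (A + C + + 1 , B + D + + 1)) ⟩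
      (Q (+ 1 , + 1) - Q (A + + 1 , B + + 1) - Q (C + + 1 , D + + 1) + Q (A + C + + 1 , B + D + + 1))
        - (Q (A , B) - Q (A , B + + 1)) - (Q (C , D) - Q (C + + 1 , D))
        + (Q (A + C , B + D) - Q (A + C + + 1 , B + D + + 1))
        ≡⟨ cong₃ (λ p q r → p - q - r + (Q (A + C , B + D) - Q (A + C + + 1 , B + D + + 1)))
                 (sym □-quadrant) (quadrant-row A B i j) (trans (quadrant-column C D i j) (ℤP.*-comm ⟦ i ≡ C ⟧ ⟦ D ≤ j ⟧)) ⟩
      □ (quadrant (+ 1 , + 1)) i j - ⟦ A ≤ i ⟧ * ⟦ j ≡ B ⟧ - ⟦ D ≤ j ⟧ * ⟦ i ≡ C ⟧
        + (quadrant (A + C , B + D) i j - quadrant (A + C + + 1 , B + D + + 1) i j) ∎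
      where
      open ≡-Reasoning
      Q : Mono → ℤ
      Q m = quadrant m i j
      □-quadrant : □ (quadrant (+ 1 , + 1)) i j
                   ≡ Q (+ 1 , + 1) - Q (A + + 1 , B + + 1) - Q (C + + 1 , D + + 1) + Q (A + C + + 1 , B + D + + 1)
      □-quadrant = cong₃ (λ p q r → Q (+ 1 , + 1) - p - q + r) (quadrant-translate A B i j) (quadrant-translate C D i j)
        (trans (cong₂ (quadrant (+ 1 , + 1)) (assoc i A C) (assoc j B D)) (quadrant-translate (A + C) (B + D) i j))

    coefficients-agree : ∀ k l → coeff lhs (k , l) ≡ coeff rhs (k , l)
    coefficients-agree k l = begin
      coeff lhs (k , l)               ≡⟨ lhs-coeff k l ⟩
      ∇ lhs-cumulative k l            ≡⟨ ∇-cong pointwise k l ⟩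
      ∇ (λ i j → □ (quadrant (+ 1 , + 1)) i j - ⟦ A ≤ i ⟧ * ⟦ j ≡ B ⟧ - ⟦ D ≤ j ⟧ * ⟦ i ≡ C ⟧
                   + (quadrant (A + C , B + D) i j - quadrant (A + C + + 1 , B + D + + 1) i j)) k l
                                      ≡⟨ sym (∇-cong cumulative-rhs k l) ⟩
      ∇ (cumulative rhs) k l          ≡⟨ sym (coeff-as-∇ rhs k l) ⟩
      coeff rhs (k , l)               ∎
      where open ≡-Reasoning

open import Data.Nat as ℕ using (ℕ; _<_; _*_; _∸_; NonZero; >-nonZero)
open import Data.Nat.GCD using (gcd)
open import Data.Integer as ℤ using (ℤ; +_)
open import Data.Nat.Properties using (m<n⇒0<n∸m)
open import Relation.Binary.PropositionalEquality using (_≡_)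
open import Data.Product using (_,_)

theorem7 : (a b c d : ℕ) → 0 < a → (0<b : 0 < b) → (0<c : 0 < c) → 0 < d →
  (hadbc : b * c < a * d) → gcd a b ≡ 1 → gcd c d ≡ 1 →
  (x y : ℤ) → (+ a) ℤ.* x ℤ.+ (+ b) ℤ.* y ≡ + 1 →
  let instance
        nzb : NonZero b
        nzb = >-nonZero 0<b
        nzc : NonZero c
        nzc = >-nonZero 0<c
        nzΔ : NonZero (a * d ∸ b * c)
        nzΔ = >-nonZero (m<n⇒0<n∸m hadbc)
      u = mono U
      v = mono V
      one = const (+ 1)
      uAvB : Mono
      uAvB = (+ a , + b)
      uCvD : Mono
      uCvD = (+ c , + d)
  in
  u *L v *L (u -L one) *L (mono uAvB -L one) *L DC V U (+ d) c
    +L u *L v *L (v -L one) *L (mono uCvD -L one) *L DC U V (+ a) b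
    +L mono ((+ a ℤ.- y) , (+ b ℤ.+ x)) *L (u -L one) *L (v -L one)
         *L DC uAvB (ℤ.- y , x) (+ c ℤ.* x ℤ.+ + d ℤ.* y) (a * d ∸ b * c)
  ≈L mono ((+ a ℤ.+ + c) , (+ b ℤ.+ + d))
    -L mono uAvB *L (u *L v -L v +L one)
    -L mono uCvD *L (u *L v -L u +L one)
    +L u *L v
theorem7 a b c d 0<a 0<b 0<c 0<d bc<ad coprime-ab coprime-cd x y bezout (k , l) =
  Proof.Reciprocity.coefficients-agree a b c d 0<a 0<b 0<c 0<d bc<ad coprime-ab coprime-cd x y bezout k l
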